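{- Fix nonzero $a,b\in\mathbb{F}_5^n$ that are not multiples of each other. For $x,y$ independent and uniform in $\mathbb{F}_5^n$, the random vector \[\big(x\cdot x,\ x\cdot y,\ (x+a)\cdot(x+a),\ (x+a)\cdot(y+b),\ (x+2a)\cdot(x+2a),\ (x+2a)\cdot(y-2b),\ (x+3a)\cdot(x+3a),\ (x+3a)\cdot(y-b)\big)\in\mathbb{F}_5^8\] takes every value in the coset $(0,0,a\cdot a,a\cdot b,4a\cdot a,-4a\cdot b,9a\cdot a,-3a\cdot b)+\Lambda_2'$ with probability $5^{ -5}+O(5^{ -n/2})$.
   Context: $u\cdot v=\sum_i u_iv_i$ is the standard dot product on $\mathbb{F}_5^n$. $\Lambda_2'\le\mathbb{F}_5^8$ is the subspace of vectors orthogonal (under the standard dot product on $\mathbb{F}_5^8$) to $(1,0,-1,0,-1,0,1,0)$, $(0,1,0,-1,0,-1,0,1)$ and $(1,0,-3,0,3,0,-1,0)$. The $O(\cdot)$ constant is independent of $n,a,b$. -}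

module Defs where

open import Data.Nat as ℕ using (ℕ; zero; suc)
open import Data.Nat.DivMod using (_mod_)
open import Data.Fin as Fin using (Fin; toℕ; #_)
open import Data.Vec as Vec using (Vec; []; _∷_; zipWith; replicate)
open import Data.Vec.Properties using (≡-dec)
open import Data.List as List using (List; []; _∷_; concatMap; map; filter; length)
open import Data.Product using (_×_; _,_; ∃)
open import Data.Integer as ℤ using (ℤ)
open import Relation.Binary.PropositionalEquality using (_≡_; _≢_)
open import Relation.Nullary using (¬_)

F5 : Set
F5 = Fin 5

infixl 6 _+₅_ _-₅_
infixl 7 _*₅_

_+₅_ : F5 → F5 → F5
x +₅ y = (toℕ x ℕ.+ toℕ y) mod 5

_*₅_ : F5 → F5 → F5
x *₅ y = (toℕ x ℕ.* toℕ y) mod 5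

neg₅ : F5 → F5
neg₅ x = (5 ℕ.∸ toℕ x) mod 5

_-₅_ : F5 → F5 → F5
x -₅ y = x +₅ neg₅ y

F5^ : ℕ → Set
F5^ n = Vec F5 n

_⊕_ : ∀ {n} → F5^ n → F5^ n → F5^ n
_⊕_ = zipWith _+₅_

_⊖_ : ∀ {n} → F5^ n → F5^ n → F5^ n
_⊖_ = zipWith _-₅_

_·ₛ_ : ∀ {n} → F5 → F5^ n → F5^ n
c ·ₛ v = Vec.map (c *₅_) v

zeroV : ∀ {n} → F5^ n
zeroV = replicate _ Fin.zero

dot : ∀ {n} → F5^ n → F5^ n → F5
dot [] [] = Fin.zero
dot (u ∷ us) (v ∷ vs) = (u *₅ v) +₅ dot us vs

_≟V_ : ∀ {n} (u v : F5^ n) → Relation.Nullary.Dec (u ≡ v)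
_≟V_ = ≡-dec Fin._≟_

allVecs : (n : ℕ) → List (F5^ n)
allVecs zero = [] ∷ []
allVecs (suc n) = concatMap (λ c → map (c ∷_) (allVecs n)) (List.allFin 5)

Φ : ∀ {n} → F5^ n → F5^ n → F5^ n → F5^ n → F5^ 8
Φ a b x y =
    dot x x
  ∷ dot x y
  ∷ dot (x ⊕ a) (x ⊕ a)
  ∷ dot (x ⊕ a) (y ⊕ b)
  ∷ dot (x ⊕ ((# 2) ·ₛ a)) (x ⊕ ((# 2) ·ₛ a))
  ∷ dot (x ⊕ ((# 2) ·ₛ a)) (y ⊖ ((# 2) ·ₛ b))
  ∷ dot (x ⊕ ((# 3) ·ₛ a)) (x ⊕ ((# 3) ·ₛ a))
  ∷ dot (x ⊕ ((# 3) ·ₛ a)) (y ⊖ b)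
  ∷ []

count : ∀ {n} → F5^ n → F5^ n → F5^ 8 → ℕ
count {n} a b v =
  length (filter (λ xy → Φ a b (Data.Product.proj₁ xy) (Data.Product.proj₂ xy) ≟V v)
                 (concatMap (λ x → map (x ,_) (allVecs n)) (allVecs n)))

w₁ w₂ w₃ : F5^ 8
w₁ = # 1 ∷ # 0 ∷ neg₅ (# 1) ∷ # 0 ∷ neg₅ (# 1) ∷ # 0 ∷ # 1 ∷ # 0 ∷ []
w₂ = # 0 ∷ # 1 ∷ # 0 ∷ neg₅ (# 1) ∷ # 0 ∷ neg₅ (# 1) ∷ # 0 ∷ # 1 ∷ []
w₃ = # 1 ∷ # 0 ∷ neg₅ (# 3) ∷ # 0 ∷ # 3 ∷ # 0 ∷ neg₅ (# 1) ∷ # 0 ∷ []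

InΛ₂' : F5^ 8 → Set
InΛ₂' u = (dot u w₁ ≡ Fin.zero) × (dot u w₂ ≡ Fin.zero) × (dot u w₃ ≡ Fin.zero)

base : ∀ {n} → F5^ n → F5^ n → F5^ 8
base a b =
    Fin.zero
  ∷ Fin.zero
  ∷ dot a a
  ∷ dot a b
  ∷ ((# 4) *₅ dot a a)
  ∷ neg₅ ((# 4) *₅ dot a b)
  ∷ ((9 mod 5) *₅ dot a a)
  ∷ neg₅ ((# 3) *₅ dot a b)
  ∷ []

InCoset : ∀ {n} → F5^ n → F5^ n → F5^ 8 → Set
InCoset a b v = InΛ₂' (v ⊖ base a b)

NotMultiples : ∀ {n} → F5^ n → F5^ n → Set
NotMultiples a b = (¬ ∃ λ c → b ≡ c ·ₛ a) × (¬ ∃ λ c → a ≡ c ·ₛ b)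

-- |count/5^(2n) − 5^(-5)| ≤ C · 5^(-n/2), written without division/roots:
-- multiply by 5^(2n+5) and square:  (5^5·N − 5^(2n))² · 5^n ≤ C² · 5^(4n+10).
ErrorBound : ℕ → ℕ → ℕ → Set
ErrorBound C n N =
  let d = ℤ.+ (5 ℕ.^ 5 ℕ.* N) ℤ.- ℤ.+ (5 ℕ.^ (2 ℕ.* n)) in
  (d ℤ.* d) ℤ.* ℤ.+ (5 ℕ.^ n) ℤ.≤ ℤ.+ (C ℕ.* C ℕ.* 5 ℕ.^ (4 ℕ.* n ℕ.+ 10))

module Submission where

-- With q = x·x, r = x·a, p = x·b, m = x·y, e = a·y, the coordinates of Φ are (x + t a)·(x + t a) =
-- q + 2t r + t² a·a and (x + t a)·(y + s b) = m + s p + t e + t s a·b for (t, s) = (0,0), (1,1),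
-- (2,−2), (3,−1). Minus the base point they are linear in (t, s), which w₁, w₂, w₃ annihilate, so Φ
-- always lies in the coset, and on the coset coordinates 0,1,2,3,5 determine the rest. The count is
-- thus the size F(s) of a fibre of σ = (x·x, x·y, (x+a)·(x+a), (x+a)·(y+b), (x+2a)·(y−2b)), whose
-- mean over the 5⁵ values s is 5^(2n−5). If σ(x+z, y+w) = σ(x, y) then a·z = b·z = a·w = 0,
-- z·x = 2 z·z and z·y = −(x·w + z·w); as fibres of a nonzero functional have 5^(n−1) points and
-- those of two independent ones 5^(n−2), the collisions number at most 5^(4n−5) + 5^(3n−1). Hence
-- ∑ₛ (5⁵ F(s) − 5^(2n))² ≤ 5^(3n+9), which bounds every single fibre.

open import Defs
import Algebra.Properties.CommutativeSemigroup as CommutativeSemigroupProperties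
open import Algebra.Structures using (IsCommutativeSemiring)
open import Data.Bool using (true; false; if_then_else_)
open import Data.Empty using (⊥-elim)
open import Data.Fin as Fin using (#_)
open import Data.Fin.Properties using (all?)
import Data.Integer as ℤ
open import Data.Integer.Properties using (+◃n≡+n; m-n≡m⊖n; [1+m]⊖[1+n]≡m⊖n; pos-*)
open import Data.List as List using (List; []; _∷_; _++_; length; concatMap; filter; allFin)
open import Data.Nat as ℕ using (ℕ; zero; suc; _+_; _*_; _^_; _≤_; z≤n; ∣_-_∣)
open import Data.Nat.Properties
import Data.Nat.Tactic.RingSolver as ℕ-Solver
open import Data.Product using (_×_; _,_; proj₁; proj₂; ∃; uncurry)
open import Data.Vec as Vec using (Vec; []; _∷_; toList)
open import Data.Vec.Properties using (∷-injective)
open import Data.Vec.Relation.Binary.Pointwise.Inductive using ([]; _∷_; Pointwise-≡⇒≡; ≡⇒Pointwise-≡)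
open import Relation.Binary.PropositionalEquality
open import Relation.Nullary using (Dec; yes; no; does; ¬?)
open import Relation.Nullary.Decidable using (True; toWitness; dec⇒maybe; _×-dec_; _→-dec_)
open import Tactic.RingSolver using (solve; solve-∀)
open import Tactic.RingSolver.Core.AlmostCommutativeRing using (AlmostCommutativeRing)
import Tactic.RingSolver.NonReflective

module +-CS = CommutativeSemigroupProperties +-commutativeSemigroup
module *-CS = CommutativeSemigroupProperties *-commutativeSemigroup

-- Arithmetic in F5

exhaustive₁ : {P : F5 → Set} (P? : ∀ x → Dec (P x)) → {True (all? P?)} → ∀ x → P x
exhaustive₁ P? {t} = toWitness t

exhaustive₂ : {P : F5 → F5 → Set} (P? : ∀ x y → Dec (P x y)) →
              {True (all? λ x → all? (P? x))} → ∀ x y → P x y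
exhaustive₂ P? {t} = toWitness t

exhaustive₃ : {P : F5 → F5 → F5 → Set} (P? : ∀ x y z → Dec (P x y z)) →
              {True (all? λ x → all? λ y → all? (P? x y))} → ∀ x y z → P x y z
exhaustive₃ P? {t} = toWitness t

exhaustive₄ : {P : F5 → F5 → F5 → F5 → Set} (P? : ∀ x y z u → Dec (P x y z u)) →
              {True (all? λ x → all? λ y → all? λ z → all? (P? x y z))} → ∀ x y z u → P x y z u
exhaustive₄ P? {t} = toWitness t

exhaustive₆ : {P : F5 → F5 → F5 → F5 → F5 → F5 → Set} (P? : ∀ x y z u v w → Dec (P x y z u v w)) →
              {True (all? λ x → all? λ y → all? λ z → all? λ u → all? λ v → all? (P? x y z u v))} →
              ∀ x y z u v w → P x y z u v w
exhaustive₆ P? {t} = toWitness t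

+₅-assoc : ∀ x y z → (x +₅ y) +₅ z ≡ x +₅ (y +₅ z)
+₅-assoc = exhaustive₃ λ _ _ _ → _ Fin.≟ _

*₅-assoc : ∀ x y z → (x *₅ y) *₅ z ≡ x *₅ (y *₅ z)
*₅-assoc = exhaustive₃ λ _ _ _ → _ Fin.≟ _

*₅-distribˡ-+₅ : ∀ x y z → x *₅ (y +₅ z) ≡ x *₅ y +₅ x *₅ z
*₅-distribˡ-+₅ = exhaustive₃ λ _ _ _ → _ Fin.≟ _

*₅-distribʳ-+₅ : ∀ x y z → (y +₅ z) *₅ x ≡ y *₅ x +₅ z *₅ x
*₅-distribʳ-+₅ = exhaustive₃ λ _ _ _ → _ Fin.≟ _

+₅-comm : ∀ x y → x +₅ y ≡ y +₅ x
+₅-comm = exhaustive₂ λ _ _ → _ Fin.≟ _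

*₅-comm : ∀ x y → x *₅ y ≡ y *₅ x
*₅-comm = exhaustive₂ λ _ _ → _ Fin.≟ _

neg₅-distribˡ-*₅ : ∀ x y → neg₅ x *₅ y ≡ neg₅ (x *₅ y)
neg₅-distribˡ-*₅ = exhaustive₂ λ _ _ → _ Fin.≟ _

neg₅-+₅ : ∀ x y → neg₅ x +₅ neg₅ y ≡ neg₅ (x +₅ y)
neg₅-+₅ = exhaustive₂ λ _ _ → _ Fin.≟ _

+₅-identityˡ : ∀ x → # 0 +₅ x ≡ x
+₅-identityˡ = exhaustive₁ λ _ → _ Fin.≟ _

+₅-identityʳ : ∀ x → x +₅ # 0 ≡ x
+₅-identityʳ = exhaustive₁ λ _ → _ Fin.≟ _

*₅-identityˡ : ∀ x → # 1 *₅ x ≡ x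
*₅-identityˡ = exhaustive₁ λ _ → _ Fin.≟ _

*₅-identityʳ : ∀ x → x *₅ # 1 ≡ x
*₅-identityʳ = exhaustive₁ λ _ → _ Fin.≟ _

*₅-zeroˡ : ∀ x → # 0 *₅ x ≡ # 0
*₅-zeroˡ = exhaustive₁ λ _ → _ Fin.≟ _

*₅-zeroʳ : ∀ x → x *₅ # 0 ≡ # 0
*₅-zeroʳ = exhaustive₁ λ _ → _ Fin.≟ _

x+₅y≡x⇒y≡0 : ∀ x y → x +₅ y ≡ x → y ≡ # 0
x+₅y≡x⇒y≡0 = exhaustive₂ λ _ _ → (_ Fin.≟ _) →-dec (_ Fin.≟ _)

F5-isCommutativeSemiring : IsCommutativeSemiring _≡_ _+₅_ _*₅_ (# 0) (# 1)
F5-isCommutativeSemiring = record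
  { isSemiring = record
    { isSemiringWithoutAnnihilatingZero = record
      { +-isCommutativeMonoid = record
        { isMonoid = record
          { isSemigroup = record
            { isMagma = record { isEquivalence = isEquivalence ; ∙-cong = cong₂ _+₅_ }
            ; assoc = +₅-assoc }
          ; identity = +₅-identityˡ , +₅-identityʳ }
        ; comm = +₅-comm }
      ; *-cong = cong₂ _*₅_
      ; *-assoc = *₅-assoc
      ; *-identity = *₅-identityˡ , *₅-identityʳ
      ; distrib = *₅-distribˡ-+₅ , *₅-distribʳ-+₅ }
    ; zero = *₅-zeroˡ , *₅-zeroʳ }
  ; *-comm = *₅-comm }

F5-ring : AlmostCommutativeRing _ _
F5-ring = record
  { Carrier = F5 ; _≈_ = _≡_ ; _+_ = _+₅_ ; _*_ = _*₅_ ; -_ = neg₅ ; 0# = # 0 ; 1# = # 1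
  ; 0≟_ = λ x → dec⇒maybe (# 0 Fin.≟ x)
  ; isAlmostCommutativeRing = record
    { isCommutativeSemiring = F5-isCommutativeSemiring
    ; -‿cong = cong neg₅
    ; -‿*-distribˡ = neg₅-distribˡ-*₅
    ; -‿+-comm = neg₅-+₅ } }

module F5-NonReflective = Tactic.RingSolver.NonReflective F5-ring

-- Vectors and the dot product

dot-comm : ∀ {n} (u v : F5^ n) → dot u v ≡ dot v u
dot-comm [] [] = refl
dot-comm (u ∷ us) (v ∷ vs) = cong₂ _+₅_ (*₅-comm u v) (dot-comm us vs)

dot-zeroˡ : ∀ {n} (v : F5^ n) → dot zeroV v ≡ # 0
dot-zeroˡ [] = refl
dot-zeroˡ (v ∷ vs) = trans (cong (# 0 *₅ v +₅_) (dot-zeroˡ vs)) (0v+0≡0 v)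
  where
  0v+0≡0 : ∀ v → # 0 *₅ v +₅ # 0 ≡ # 0
  0v+0≡0 = solve-∀ F5-ring

dot-⊕ˡ : ∀ {n} (u v w : F5^ n) → dot (u ⊕ v) w ≡ dot u w +₅ dot v w
dot-⊕ˡ [] [] [] = refl
dot-⊕ˡ (u ∷ us) (v ∷ vs) (w ∷ ws) =
  trans (cong ((u +₅ v) *₅ w +₅_) (dot-⊕ˡ us vs ws)) ([u+v]w+[X+Y]≡[uw+X]+[vw+Y] u v w (dot us ws) (dot vs ws))
  where
  [u+v]w+[X+Y]≡[uw+X]+[vw+Y] : ∀ u v w X Y → (u +₅ v) *₅ w +₅ (X +₅ Y) ≡ (u *₅ w +₅ X) +₅ (v *₅ w +₅ Y)
  [u+v]w+[X+Y]≡[uw+X]+[vw+Y] = solve-∀ F5-ring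

dot-·ₛˡ : ∀ {n} c (u w : F5^ n) → dot (c ·ₛ u) w ≡ c *₅ dot u w
dot-·ₛˡ c [] [] = sym (*₅-zeroʳ c)
dot-·ₛˡ c (u ∷ us) (w ∷ ws) =
  trans (cong ((c *₅ u) *₅ w +₅_) (dot-·ₛˡ c us ws)) ([cu]w+cX≡c[uw+X] c u w (dot us ws))
  where
  [cu]w+cX≡c[uw+X] : ∀ c u w X → (c *₅ u) *₅ w +₅ c *₅ X ≡ c *₅ (u *₅ w +₅ X)
  [cu]w+cX≡c[uw+X] = solve-∀ F5-ring

dot-⊕ʳ : ∀ {n} (u v w : F5^ n) → dot w (u ⊕ v) ≡ dot w u +₅ dot w v
dot-⊕ʳ u v w = begin
  dot w (u ⊕ v)         ≡⟨ dot-comm w (u ⊕ v) ⟩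
  dot (u ⊕ v) w         ≡⟨ dot-⊕ˡ u v w ⟩
  dot u w +₅ dot v w    ≡⟨ cong₂ _+₅_ (dot-comm u w) (dot-comm v w) ⟩
  dot w u +₅ dot w v    ∎
  where open ≡-Reasoning

dot-·ₛʳ : ∀ {n} c (u w : F5^ n) → dot w (c ·ₛ u) ≡ c *₅ dot w u
dot-·ₛʳ c u w = begin
  dot w (c ·ₛ u)    ≡⟨ dot-comm w (c ·ₛ u) ⟩
  dot (c ·ₛ u) w    ≡⟨ dot-·ₛˡ c u w ⟩
  c *₅ dot u w      ≡⟨ cong (c *₅_) (dot-comm u w) ⟩
  c *₅ dot w u      ∎
  where open ≡-Reasoning

dot-⊖ˡ : ∀ {n} (u v w : F5^ n) → dot (u ⊖ v) w ≡ dot u w -₅ dot v w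
dot-⊖ˡ [] [] [] = refl
dot-⊖ˡ (u ∷ us) (v ∷ vs) (w ∷ ws) =
  trans (cong ((u -₅ v) *₅ w +₅_) (dot-⊖ˡ us vs ws)) ([u-v]w+[X-Y]≡[uw+X]-[vw+Y] u v w (dot us ws) (dot vs ws))
  where
  [u-v]w+[X-Y]≡[uw+X]-[vw+Y] : ∀ u v w X Y → (u -₅ v) *₅ w +₅ (X -₅ Y) ≡ (u *₅ w +₅ X) -₅ (v *₅ w +₅ Y)
  [u-v]w+[X-Y]≡[uw+X]-[vw+Y] = solve-∀ F5-ring

dot-⊖-·ₛ : ∀ {n} t (a b z : F5^ n) → dot (b ⊖ (t ·ₛ a)) z ≡ dot b z -₅ t *₅ dot a z
dot-⊖-·ₛ t a b z = trans (dot-⊖ˡ b (t ·ₛ a) z) (cong (dot b z -₅_) (dot-·ₛˡ t a z))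

dot-⊕-⊕ : ∀ {n} (x z y w : F5^ n) → dot (x ⊕ z) (y ⊕ w) ≡ (dot x y +₅ dot x w) +₅ (dot z y +₅ dot z w)
dot-⊕-⊕ x z y w = trans (dot-⊕ˡ x z (y ⊕ w)) (cong₂ _+₅_ (dot-⊕ʳ y w x) (dot-⊕ʳ y w z))

dot-translate : ∀ {n} t s (x a y b : F5^ n) →
  dot (x ⊕ (t ·ₛ a)) (y ⊕ (s ·ₛ b)) ≡ dot x y +₅ s *₅ dot x b +₅ t *₅ dot a y +₅ t *₅ s *₅ dot a b
dot-translate t s x a y b = begin
  dot (x ⊕ (t ·ₛ a)) (y ⊕ (s ·ₛ b))
    ≡⟨ dot-⊕ˡ x (t ·ₛ a) _ ⟩
  dot x (y ⊕ (s ·ₛ b)) +₅ dot (t ·ₛ a) (y ⊕ (s ·ₛ b))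
    ≡⟨ cong₂ _+₅_ (dot-⊕ʳ y _ x) (trans (dot-·ₛˡ t a _) (cong (t *₅_) (dot-⊕ʳ y _ a))) ⟩
  dot x y +₅ dot x (s ·ₛ b) +₅ t *₅ (dot a y +₅ dot a (s ·ₛ b))
    ≡⟨ cong₂ (λ X Y → dot x y +₅ X +₅ t *₅ (dot a y +₅ Y)) (dot-·ₛʳ s b x) (dot-·ₛʳ s b a) ⟩
  dot x y +₅ s *₅ dot x b +₅ t *₅ (dot a y +₅ s *₅ dot a b)
    ≡⟨ m+sp+t[e+sB]≡m+sp+te+tsB t s (dot x y) (dot x b) (dot a y) (dot a b) ⟩
  dot x y +₅ s *₅ dot x b +₅ t *₅ dot a y +₅ t *₅ s *₅ dot a b ∎
  where
  open ≡-Reasoning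
  m+sp+t[e+sB]≡m+sp+te+tsB : ∀ t s m p e B → m +₅ s *₅ p +₅ t *₅ (e +₅ s *₅ B) ≡ m +₅ s *₅ p +₅ t *₅ e +₅ t *₅ s *₅ B
  m+sp+t[e+sB]≡m+sp+te+tsB = solve-∀ F5-ring

dot-translate-self : ∀ {n} t (x a : F5^ n) →
  dot (x ⊕ (t ·ₛ a)) (x ⊕ (t ·ₛ a)) ≡ dot x x +₅ t *₅ dot x a +₅ t *₅ dot x a +₅ t *₅ t *₅ dot a a
dot-translate-self t x a =
  trans (dot-translate t t x a x a) (cong (λ e → dot x x +₅ t *₅ dot x a +₅ t *₅ e +₅ t *₅ t *₅ dot a a) (dot-comm a x))

·ₛ-identityˡ : ∀ {n} (v : F5^ n) → (# 1) ·ₛ v ≡ v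
·ₛ-identityˡ [] = refl
·ₛ-identityˡ (v ∷ vs) = cong₂ _∷_ (*₅-identityˡ v) (·ₛ-identityˡ vs)

⊖-·ₛ : ∀ {n} c (u v : F5^ n) → u ⊖ (c ·ₛ v) ≡ u ⊕ (neg₅ c ·ₛ v)
⊖-·ₛ c [] [] = refl
⊖-·ₛ c (u ∷ us) (v ∷ vs) = cong₂ _∷_ (u-cv≡u+[-c]v c u v) (⊖-·ₛ c us vs)
  where
  u-cv≡u+[-c]v : ∀ c u v → u -₅ c *₅ v ≡ u +₅ neg₅ c *₅ v
  u-cv≡u+[-c]v = solve-∀ F5-ring

⊖-self : ∀ {n} (u : F5^ n) → u ⊖ u ≡ zeroV
⊖-self [] = refl
⊖-self (u ∷ us) = cong₂ _∷_ (u-u≡0 u) (⊖-self us)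
  where
  u-u≡0 : ∀ u → u -₅ u ≡ # 0
  u-u≡0 = solve-∀ F5-ring

⊖≡zero⇒≡ : ∀ {n} {u v : F5^ n} → u ⊖ v ≡ zeroV → u ≡ v
⊖≡zero⇒≡ {u = []} {[]} _ = refl
⊖≡zero⇒≡ {u = u ∷ us} {v ∷ vs} eq with ∷-injective eq
... | head , tail = cong₂ _∷_ (u-v≡0⇒u≡v u v head) (⊖≡zero⇒≡ tail)
  where
  u-v≡0⇒u≡v : ∀ u v → u -₅ v ≡ # 0 → u ≡ v
  u-v≡0⇒u≡v = exhaustive₂ λ _ _ → (_ Fin.≟ _) →-dec (_ Fin.≟ _)

⊖-⊖-cancelʳ : ∀ {n} (u v w : F5^ n) → (u ⊖ w) ⊖ (v ⊖ w) ≡ u ⊖ v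
⊖-⊖-cancelʳ [] [] [] = refl
⊖-⊖-cancelʳ (u ∷ us) (v ∷ vs) (w ∷ ws) = cong₂ _∷_ ([u-w]-[v-w]≡u-v u v w) (⊖-⊖-cancelʳ us vs ws)
  where
  [u-w]-[v-w]≡u-v : ∀ u v w → (u -₅ w) -₅ (v -₅ w) ≡ u -₅ v
  [u-w]-[v-w]≡u-v = solve-∀ F5-ring

⊕≡⇒⊖≡ : ∀ {n} {x z s : F5^ n} → x ⊕ z ≡ s → s ⊖ x ≡ z
⊕≡⇒⊖≡ {x = []} {[]} {[]} _ = refl
⊕≡⇒⊖≡ {x = x ∷ xs} {z ∷ zs} {s ∷ ss} eq with ∷-injective eq
... | head , tail = cong₂ _∷_ (x+z≡s⇒s-x≡z x z s head) (⊕≡⇒⊖≡ tail)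
  where
  x+z≡s⇒s-x≡z : ∀ x z s → x +₅ z ≡ s → s -₅ x ≡ z
  x+z≡s⇒s-x≡z = exhaustive₃ λ _ _ _ → (_ Fin.≟ _) →-dec (_ Fin.≟ _)

⊖≡⇒⊕≡ : ∀ {n} {x z s : F5^ n} → s ⊖ x ≡ z → x ⊕ z ≡ s
⊖≡⇒⊕≡ {x = []} {[]} {[]} _ = refl
⊖≡⇒⊕≡ {x = x ∷ xs} {z ∷ zs} {s ∷ ss} eq with ∷-injective eq
... | head , tail = cong₂ _∷_ (s-x≡z⇒x+z≡s x z s head) (⊖≡⇒⊕≡ tail)
  where
  s-x≡z⇒x+z≡s : ∀ x z s → s -₅ x ≡ z → x +₅ z ≡ s
  s-x≡z⇒x+z≡s = exhaustive₃ λ _ _ _ → (_ Fin.≟ _) →-dec (_ Fin.≟ _)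

-- The coset of Λ₂'

π : F5^ 8 → F5^ 5
π (u0 ∷ u1 ∷ u2 ∷ u3 ∷ _ ∷ u5 ∷ _ ∷ _ ∷ []) = u0 ∷ u1 ∷ u2 ∷ u3 ∷ u5 ∷ []

π-⊖ : ∀ u v → π (u ⊖ v) ≡ π u ⊖ π v
π-⊖ (_ ∷ _ ∷ _ ∷ _ ∷ _ ∷ _ ∷ _ ∷ _ ∷ []) (_ ∷ _ ∷ _ ∷ _ ∷ _ ∷ _ ∷ _ ∷ _ ∷ []) = refl

InΛ₂'? : ∀ u → Dec (InΛ₂' u)
InΛ₂'? u = (dot u w₁ Fin.≟ # 0) ×-dec (dot u w₂ Fin.≟ # 0) ×-dec (dot u w₃ Fin.≟ # 0)

Λ₂'-⊖ : ∀ u v → InΛ₂' u → InΛ₂' v → InΛ₂' (u ⊖ v)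
Λ₂'-⊖ u v (u₁ , u₂ , u₃) (v₁ , v₂ , v₃) = orthogonal w₁ u₁ v₁ , orthogonal w₂ u₂ v₂ , orthogonal w₃ u₃ v₃
  where
  orthogonal : ∀ w → dot u w ≡ # 0 → dot v w ≡ # 0 → dot (u ⊖ v) w ≡ # 0
  orthogonal w u⊥w v⊥w = trans (dot-⊖ˡ u v w) (cong₂ _-₅_ u⊥w v⊥w)

Λ₂'∩ker-π : ∀ u → InΛ₂' u → π u ≡ zeroV → u ≡ zeroV
Λ₂'∩ker-π (_ ∷ _ ∷ _ ∷ _ ∷ u4 ∷ _ ∷ u6 ∷ u7 ∷ []) inΛ refl = kernel-vector≡0 u4 u6 u7 inΛ
  where
  kernel-vector : F5 → F5 → F5 → F5^ 8
  kernel-vector u4 u6 u7 = # 0 ∷ # 0 ∷ # 0 ∷ # 0 ∷ u4 ∷ # 0 ∷ u6 ∷ u7 ∷ []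
  kernel-vector≡0 : ∀ u4 u6 u7 → InΛ₂' (kernel-vector u4 u6 u7) → kernel-vector u4 u6 u7 ≡ zeroV
  kernel-vector≡0 = exhaustive₃ λ u4 u6 u7 → InΛ₂'? (kernel-vector u4 u6 u7) →-dec (_ ≟V zeroV)

coset-injective-π : ∀ c v v' → InΛ₂' (v ⊖ c) → InΛ₂' (v' ⊖ c) → π v ≡ π v' → v ≡ v'
coset-injective-π c v v' v∈ v'∈ πv≡πv' = ⊖≡zero⇒≡ (Λ₂'∩ker-π (v ⊖ v') difference∈Λ₂' π-difference≡0)
  where
  difference∈Λ₂' : InΛ₂' (v ⊖ v')
  difference∈Λ₂' = subst InΛ₂' (⊖-⊖-cancelʳ v v' c) (Λ₂'-⊖ (v ⊖ c) (v' ⊖ c) v∈ v'∈)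
  π-difference≡0 : π (v ⊖ v') ≡ zeroV
  π-difference≡0 = trans (π-⊖ v v') (trans (cong (π v ⊖_) (sym πv≡πv')) (⊖-self (π v)))

-- The equation u ≡ (u0 ∷ …) only names the components of u, so that callers can leave them to unification.
InΛ₂'-from-forms : ∀ u {u0 u1 u2 u3 u4 u5 u6 u7} → u ≡ (u0 ∷ u1 ∷ u2 ∷ u3 ∷ u4 ∷ u5 ∷ u6 ∷ u7 ∷ []) →
  u0 -₅ u2 -₅ u4 +₅ u6 ≡ # 0 → u1 -₅ u3 -₅ u5 +₅ u7 ≡ # 0 → u0 -₅ # 3 *₅ u2 +₅ # 3 *₅ u4 -₅ u6 ≡ # 0 → InΛ₂' u
InΛ₂'-from-forms _ {u0} {u1} {u2} {u3} {u4} {u5} {u6} {u7} refl ℓ₁ ℓ₂ ℓ₃ =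
  trans (form₁ u0 u1 u2 u3 u4 u5 u6 u7) ℓ₁ , trans (form₂ u0 u1 u2 u3 u4 u5 u6 u7) ℓ₂ , trans (form₃ u0 u1 u2 u3 u4 u5 u6 u7) ℓ₃
  where
  -- dot on solver expressions: the denotation of dotᴱ us vs is, by definition, dot of the denotations
  dotᴱ : ∀ {k m} → Vec (F5-NonReflective.Expr F5 k) m → Vec (F5-NonReflective.Expr F5 k) m → F5-NonReflective.Expr F5 k
  dotᴱ [] [] = F5-NonReflective.Κ (# 0)
  dotᴱ (u ∷ us) (v ∷ vs) = u F5-NonReflective.⊗ v F5-NonReflective.⊕ dotᴱ us vs
  open F5-NonReflective using (_⊜_; ⊝_; Κ) renaming (_⊕_ to _+ᴱ_; _⊗_ to _*ᴱ_)
  form₁ : ∀ u0 u1 u2 u3 u4 u5 u6 u7 → dot (u0 ∷ u1 ∷ u2 ∷ u3 ∷ u4 ∷ u5 ∷ u6 ∷ u7 ∷ []) w₁ ≡ u0 -₅ u2 -₅ u4 +₅ u6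
  form₁ = F5-NonReflective.solve 8 (λ u0 u1 u2 u3 u4 u5 u6 u7 → dotᴱ (u0 ∷ u1 ∷ u2 ∷ u3 ∷ u4 ∷ u5 ∷ u6 ∷ u7 ∷ []) (Vec.map Κ w₁) ⊜
                     (u0 +ᴱ ⊝ u2 +ᴱ ⊝ u4 +ᴱ u6)) refl
  form₂ : ∀ u0 u1 u2 u3 u4 u5 u6 u7 → dot (u0 ∷ u1 ∷ u2 ∷ u3 ∷ u4 ∷ u5 ∷ u6 ∷ u7 ∷ []) w₂ ≡ u1 -₅ u3 -₅ u5 +₅ u7
  form₂ = F5-NonReflective.solve 8 (λ u0 u1 u2 u3 u4 u5 u6 u7 → dotᴱ (u0 ∷ u1 ∷ u2 ∷ u3 ∷ u4 ∷ u5 ∷ u6 ∷ u7 ∷ []) (Vec.map Κ w₂) ⊜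
                     (u1 +ᴱ ⊝ u3 +ᴱ ⊝ u5 +ᴱ u7)) refl
  form₃ : ∀ u0 u1 u2 u3 u4 u5 u6 u7 → dot (u0 ∷ u1 ∷ u2 ∷ u3 ∷ u4 ∷ u5 ∷ u6 ∷ u7 ∷ []) w₃ ≡ u0 -₅ # 3 *₅ u2 +₅ # 3 *₅ u4 -₅ u6
  form₃ = F5-NonReflective.solve 8 (λ u0 u1 u2 u3 u4 u5 u6 u7 → dotᴱ (u0 ∷ u1 ∷ u2 ∷ u3 ∷ u4 ∷ u5 ∷ u6 ∷ u7 ∷ []) (Vec.map Κ w₃) ⊜
                     (u0 +ᴱ ⊝ (Κ (# 3) *ᴱ u2) +ᴱ Κ (# 3) *ᴱ u4 +ᴱ ⊝ u6)) refl

-- Φ in terms of q = x·x, r = x·a, p = x·b, m = x·y, e = a·y, A = a·a, B = a·b;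
-- S t is (x + t a)·(x + t a) and M t s is (x + t a)·(y + s b).
Φ-form : (q r p m e A B : F5) → F5^ 8
Φ-form q r p m e A B =
  let S t   = q +₅ t *₅ r +₅ t *₅ r +₅ t *₅ t *₅ A
      M t s = m +₅ s *₅ p +₅ t *₅ e +₅ t *₅ s *₅ B
  in  q ∷ m ∷ S (# 1) ∷ M (# 1) (# 1) ∷ S (# 2) ∷ M (# 2) (neg₅ (# 2)) ∷ S (# 3) ∷ M (# 3) (neg₅ (# 1)) ∷ []

-- base a b as a function of A = a·a and B = a·b (9 mod 5 is 4).
base-form : (A B : F5) → F5^ 8
base-form A B = # 0 ∷ # 0 ∷ A ∷ B ∷ # 4 *₅ A ∷ neg₅ (# 4 *₅ B) ∷ # 4 *₅ A ∷ neg₅ (# 3 *₅ B) ∷ []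

Φ-form-in-coset : ∀ q r p m e A B → InΛ₂' (Φ-form q r p m e A B ⊖ base-form A B)
Φ-form-in-coset q r p m e A B = InΛ₂'-from-forms (Φ-form q r p m e A B ⊖ base-form A B) refl
  (solve (toList (q ∷ r ∷ A ∷ [])) F5-ring)
  (solve (toList (m ∷ p ∷ e ∷ B ∷ [])) F5-ring)
  (solve (toList (q ∷ r ∷ A ∷ [])) F5-ring)

Φ-expansion : ∀ {n} (a b x y : F5^ n) →
  Φ a b x y ≡ Φ-form (dot x x) (dot x a) (dot x b) (dot x y) (dot a y) (dot a a) (dot a b)
Φ-expansion a b x y = Pointwise-≡⇒≡
  ( refl ∷ refl
  ∷ trans (cong (λ v → dot v v) x⊕a) (dot-translate-self (# 1) x a)
  ∷ trans (cong₂ dot x⊕a y⊕b) (dot-translate (# 1) (# 1) x a y b)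
  ∷ dot-translate-self (# 2) x a
  ∷ trans (cong (dot (x ⊕ ((# 2) ·ₛ a))) (⊖-·ₛ (# 2) y b)) (dot-translate (# 2) (neg₅ (# 2)) x a y b)
  ∷ dot-translate-self (# 3) x a
  ∷ trans (cong (dot (x ⊕ ((# 3) ·ₛ a))) y⊖b) (dot-translate (# 3) (neg₅ (# 1)) x a y b)
  ∷ [])
  where
  x⊕a : x ⊕ a ≡ x ⊕ ((# 1) ·ₛ a)
  x⊕a = cong (x ⊕_) (sym (·ₛ-identityˡ a))
  y⊕b : y ⊕ b ≡ y ⊕ ((# 1) ·ₛ b)
  y⊕b = cong (y ⊕_) (sym (·ₛ-identityˡ b))
  y⊖b : y ⊖ b ≡ y ⊕ (neg₅ (# 1) ·ₛ b)
  y⊖b = trans (cong (y ⊖_) (sym (·ₛ-identityˡ b))) (⊖-·ₛ (# 1) y b)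

Φ-in-coset : ∀ {n} (a b x y : F5^ n) → InCoset a b (Φ a b x y)
Φ-in-coset a b x y = subst (λ v → InΛ₂' (v ⊖ base a b)) (sym (Φ-expansion a b x y))
  (Φ-form-in-coset (dot x x) (dot x a) (dot x b) (dot x y) (dot a y) (dot a a) (dot a b))

σ : ∀ {n} → F5^ n → F5^ n → F5^ n → F5^ n → F5^ 5
σ a b x y = π (Φ a b x y)

Φ-determined-by-σ : ∀ {n} (a b x y : F5^ n) v → InCoset a b v → σ a b x y ≡ π v → Φ a b x y ≡ v
Φ-determined-by-σ a b x y v = coset-injective-π (base a b) (Φ a b x y) v (Φ-in-coset a b x y)

record SameStatistics (q r p m e q' r' p' m' e' : F5) : Set where
  field
    q≡q' : q ≡ q'
    r≡r' : r ≡ r'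
    p≡p' : p ≡ p'
    m≡m' : m ≡ m'
    e≡e' : e ≡ e'

σ-form-injective : ∀ q r p m e q' r' p' m' e' A B →
  π (Φ-form q r p m e A B) ≡ π (Φ-form q' r' p' m' e' A B) → SameStatistics q r p m e q' r' p' m' e'
σ-form-injective q r p m e q' r' p' m' e' A B eq with ≡⇒Pointwise-≡ eq
... | refl ∷ refl ∷ σ₂ ∷ σ₃ ∷ σ₅ ∷ [] = record
  { q≡q' = refl
  ; r≡r' = σ₂⇒r≡r' q A r r' σ₂
  ; p≡p' = proj₁ (σ₃σ₅⇒p≡p'×e≡e' m B p e p' e' σ₃ σ₅)
  ; m≡m' = refl
  ; e≡e' = proj₂ (σ₃σ₅⇒p≡p'×e≡e' m B p e p' e' σ₃ σ₅)
  }
  where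
  σ₂⇒r≡r' : ∀ q A r r' → q +₅ # 1 *₅ r +₅ # 1 *₅ r +₅ # 1 *₅ # 1 *₅ A ≡ q +₅ # 1 *₅ r' +₅ # 1 *₅ r' +₅ # 1 *₅ # 1 *₅ A → r ≡ r'
  σ₂⇒r≡r' = exhaustive₄ λ _ _ _ _ → (_ Fin.≟ _) →-dec (_ Fin.≟ _)
  σ₃σ₅⇒p≡p'×e≡e' : ∀ m B p e p' e' →
    m +₅ # 1 *₅ p +₅ # 1 *₅ e +₅ # 1 *₅ # 1 *₅ B ≡ m +₅ # 1 *₅ p' +₅ # 1 *₅ e' +₅ # 1 *₅ # 1 *₅ B →
    m +₅ neg₅ (# 2) *₅ p +₅ # 2 *₅ e +₅ # 2 *₅ neg₅ (# 2) *₅ B ≡ m +₅ neg₅ (# 2) *₅ p' +₅ # 2 *₅ e' +₅ # 2 *₅ neg₅ (# 2) *₅ B →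
    p ≡ p' × e ≡ e'
  σ₃σ₅⇒p≡p'×e≡e' = exhaustive₆ λ _ _ _ _ _ _ → (_ Fin.≟ _) →-dec ((_ Fin.≟ _) →-dec ((_ Fin.≟ _) ×-dec (_ Fin.≟ _)))

σ-determines-statistics : ∀ {n} (a b x y x' y' : F5^ n) → σ a b x y ≡ σ a b x' y' →
  SameStatistics (dot x x) (dot x a) (dot x b) (dot x y) (dot a y) (dot x' x') (dot x' a) (dot x' b) (dot x' y') (dot a y')
σ-determines-statistics a b x y x' y' eq =
  σ-form-injective (dot x x) (dot x a) (dot x b) (dot x y) (dot a y) (dot x' x') (dot x' a) (dot x' b) (dot x' y') (dot a y')
    (dot a a) (dot a b) (trans (sym (cong π (Φ-expansion a b x y))) (trans eq (cong π (Φ-expansion a b x' y'))))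

-- Finite sums

∑ : {A : Set} → List A → (A → ℕ) → ℕ
∑ []       f = 0
∑ (x ∷ xs) f = f x + ∑ xs f

syntax ∑ L (λ x → e) = ∑[ x ← L ] e

𝟙 : {P : Set} → Dec P → ℕ
𝟙 d = if does d then 1 else 0

module _ {A : Set} where

  ∑-cong : ∀ (L : List A) {f g : A → ℕ} → (∀ x → f x ≡ g x) → ∑ L f ≡ ∑ L g
  ∑-cong []      f≡g = refl
  ∑-cong (x ∷ L) f≡g = cong₂ _+_ (f≡g x) (∑-cong L f≡g)

  ∑-mono-≤ : ∀ (L : List A) {f g : A → ℕ} → (∀ x → f x ≤ g x) → ∑ L f ≤ ∑ L g
  ∑-mono-≤ []      f≤g = ≤-refl
  ∑-mono-≤ (x ∷ L) f≤g = +-mono-≤ (f≤g x) (∑-mono-≤ L f≤g)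

  ∑-+ : ∀ (L : List A) (f g : A → ℕ) → ∑[ x ← L ] (f x + g x) ≡ ∑ L f + ∑ L g
  ∑-+ []      f g = refl
  ∑-+ (x ∷ L) f g = trans (cong (f x + g x +_) (∑-+ L f g)) (+-CS.interchange (f x) (g x) (∑ L f) (∑ L g))

  ∑-*ˡ : ∀ (L : List A) k (f : A → ℕ) → ∑[ x ← L ] (k * f x) ≡ k * ∑ L f
  ∑-*ˡ []      k f = sym (*-zeroʳ k)
  ∑-*ˡ (x ∷ L) k f = trans (cong (k * f x +_) (∑-*ˡ L k f)) (sym (*-distribˡ-+ k (f x) (∑ L f)))

  ∑-*ʳ : ∀ (L : List A) (f : A → ℕ) k → ∑[ x ← L ] (f x * k) ≡ ∑ L f * k
  ∑-*ʳ L f k = trans (∑-cong L (λ x → *-comm (f x) k)) (trans (∑-*ˡ L k f) (*-comm k (∑ L f)))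

  ∑-const : ∀ (L : List A) k → ∑[ _ ← L ] k ≡ k * length L
  ∑-const []      k = sym (*-zeroʳ k)
  ∑-const (x ∷ L) k = trans (cong (k +_) (∑-const L k)) (sym (*-suc k (length L)))

  ∑-++ : ∀ (L M : List A) (f : A → ℕ) → ∑ (L ++ M) f ≡ ∑ L f + ∑ M f
  ∑-++ []      M f = refl
  ∑-++ (x ∷ L) M f = trans (cong (f x +_) (∑-++ L M f)) (sym (+-assoc (f x) _ _))

  length-filter≡∑-𝟙 : {P : A → Set} (P? : ∀ x → Dec (P x)) (L : List A) → length (filter P? L) ≡ ∑[ x ← L ] 𝟙 (P? x)
  length-filter≡∑-𝟙 P? []      = refl
  length-filter≡∑-𝟙 P? (x ∷ L) with does (P? x)
  ... | true  = cong suc (length-filter≡∑-𝟙 P? L)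
  ... | false = length-filter≡∑-𝟙 P? L

module _ {A B : Set} where

  ∑-swap : ∀ (L : List A) (M : List B) (f : A → B → ℕ) → ∑[ x ← L ] ∑[ y ← M ] f x y ≡ ∑[ y ← M ] ∑[ x ← L ] f x y
  ∑-swap []      M f = sym (trans (∑-const M 0) (*-zeroˡ (length M)))
  ∑-swap (x ∷ L) M f = trans (cong (∑ M (f x) +_) (∑-swap L M f)) (sym (∑-+ M (f x) λ y → ∑[ x ← L ] f x y))

  ∑-map : ∀ (L : List A) (h : A → B) (f : B → ℕ) → ∑ (List.map h L) f ≡ ∑[ x ← L ] f (h x)
  ∑-map []      h f = refl
  ∑-map (x ∷ L) h f = cong (f (h x) +_) (∑-map L h f)

  ∑-concatMap : ∀ (L : List A) (g : A → List B) (f : B → ℕ) → ∑ (concatMap g L) f ≡ ∑[ x ← L ] ∑ (g x) f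
  ∑-concatMap []      g f = refl
  ∑-concatMap (x ∷ L) g f = trans (∑-++ (g x) (concatMap g L) f) (cong (∑ (g x) f +_) (∑-concatMap L g f))

𝟙≤1 : ∀ {P : Set} (P? : Dec P) → 𝟙 P? ≤ 1
𝟙≤1 (yes _) = ≤-refl
𝟙≤1 (no _)  = z≤n

𝟙-yes : ∀ {P : Set} (P? : Dec P) → P → 𝟙 P? ≡ 1
𝟙-yes (yes _) _ = refl
𝟙-yes (no ¬p) p = ⊥-elim (¬p p)

𝟙-mono-≤ : ∀ {P Q : Set} (P? : Dec P) (Q? : Dec Q) → (P → Q) → 𝟙 P? ≤ 𝟙 Q?
𝟙-mono-≤ (yes p) Q? P→Q = ≤-reflexive (sym (𝟙-yes Q? (P→Q p)))
𝟙-mono-≤ (no _)  Q? P→Q = z≤n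

𝟙-cong : ∀ {P Q : Set} (P? : Dec P) (Q? : Dec Q) → (P → Q) → (Q → P) → 𝟙 P? ≡ 𝟙 Q?
𝟙-cong P? Q? P→Q Q→P = ≤-antisym (𝟙-mono-≤ P? Q? P→Q) (𝟙-mono-≤ Q? P? Q→P)

𝟙-× : ∀ {P Q : Set} (P? : Dec P) (Q? : Dec Q) → 𝟙 (P? ×-dec Q?) ≡ 𝟙 P? * 𝟙 Q?
𝟙-× (yes _) (yes _) = refl
𝟙-× (yes _) (no _)  = refl
𝟙-× (no _)  Q?      = refl

𝟙-×₅ : ∀ {P Q R S T : Set} (P? : Dec P) (Q? : Dec Q) (R? : Dec R) (S? : Dec S) (T? : Dec T) →
  𝟙 (P? ×-dec Q? ×-dec R? ×-dec S? ×-dec T?) ≡ 𝟙 P? * (𝟙 Q? * (𝟙 R? * (𝟙 S? * 𝟙 T?)))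
𝟙-×₅ P? Q? R? S? T? =
  trans (𝟙-× P? (Q? ×-dec R? ×-dec S? ×-dec T?)) (cong (𝟙 P? *_)
    (trans (𝟙-× Q? (R? ×-dec S? ×-dec T?)) (cong (𝟙 Q? *_) (trans (𝟙-× R? (S? ×-dec T?)) (cong (𝟙 R? *_) (𝟙-× S? T?))))))

∑-product-count : ∀ {A : Set} (L : List A) (g f : A → ℕ) k m {Q c} →
  k * ∑ L g ≡ Q → (∀ x → m * f x ≡ c) → k * m * ∑[ x ← L ] (g x * f x) ≡ Q * c
∑-product-count L g f k m {Q} {c} k∑g≡Q mf≡c = begin
  k * m * ∑[ x ← L ] (g x * f x)        ≡⟨ *-assoc k m _ ⟩
  k * (m * ∑[ x ← L ] (g x * f x))      ≡⟨ cong (k *_) (sym (∑-*ˡ L m λ x → g x * f x)) ⟩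
  k * ∑[ x ← L ] (m * (g x * f x))      ≡⟨ cong (k *_) (∑-cong L λ x → trans (*-CS.x∙yz≈y∙xz m (g x) (f x)) (cong (g x *_) (mf≡c x))) ⟩
  k * ∑[ x ← L ] (g x * c)              ≡⟨ cong (k *_) (∑-*ʳ L g c) ⟩
  k * (∑ L g * c)                       ≡⟨ sym (*-assoc k _ c) ⟩
  k * ∑ L g * c                         ≡⟨ cong (_* c) k∑g≡Q ⟩
  Q * c                                 ∎
  where open ≡-Reasoning

∑-reorder₄ : ∀ {A B C D : Set} (LA : List A) (LB : List B) (LC : List C) (LD : List D) (f : A → B → C → D → ℕ) →
  ∑[ x ← LA ] ∑[ y ← LB ] ∑[ z ← LC ] ∑[ w ← LD ] f x y z w ≡ ∑[ z ← LC ] ∑[ x ← LA ] ∑[ w ← LD ] ∑[ y ← LB ] f x y z w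
∑-reorder₄ LA LB LC LD f = begin
  ∑[ x ← LA ] ∑[ y ← LB ] ∑[ z ← LC ] ∑[ w ← LD ] f x y z w
    ≡⟨ ∑-cong LA (λ x → ∑-swap LB LC λ y z → ∑[ w ← LD ] f x y z w) ⟩
  ∑[ x ← LA ] ∑[ z ← LC ] ∑[ y ← LB ] ∑[ w ← LD ] f x y z w
    ≡⟨ ∑-swap LA LC (λ x z → ∑[ y ← LB ] ∑[ w ← LD ] f x y z w) ⟩
  ∑[ z ← LC ] ∑[ x ← LA ] ∑[ y ← LB ] ∑[ w ← LD ] f x y z w
    ≡⟨ ∑-cong LC (λ z → ∑-cong LA λ x → ∑-swap LB LD λ y w → f x y z w) ⟩
  ∑[ z ← LC ] ∑[ x ← LA ] ∑[ w ← LD ] ∑[ y ← LB ] f x y z w ∎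
  where open ≡-Reasoning

∣m-n∣²+2mn≡m²+n² : ∀ m n → ∣ m - n ∣ * ∣ m - n ∣ + 2 * (m * n) ≡ m * m + n * n
∣m-n∣²+2mn≡m²+n² zero    n       = +-identityʳ (n * n)
∣m-n∣²+2mn≡m²+n² (suc m) zero    = cong (λ t → suc m * suc m + 2 * t) (*-zeroʳ (suc m))
∣m-n∣²+2mn≡m²+n² (suc m) (suc n) = begin
  ∣ m - n ∣ * ∣ m - n ∣ + 2 * (suc m * suc n)              ≡⟨ d+2[1+m][1+n]≡d+2mn+2[m+n+1] (∣ m - n ∣ * ∣ m - n ∣) m n ⟩
  (∣ m - n ∣ * ∣ m - n ∣ + 2 * (m * n)) + 2 * (m + n + 1)  ≡⟨ cong (_+ 2 * (m + n + 1)) (∣m-n∣²+2mn≡m²+n² m n) ⟩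
  (m * m + n * n) + 2 * (m + n + 1)                        ≡⟨ m²+n²+2[m+n+1]≡[1+m]²+[1+n]² m n ⟩
  suc m * suc m + suc n * suc n                            ∎
  where
  open ≡-Reasoning
  d+2[1+m][1+n]≡d+2mn+2[m+n+1] : ∀ d m n → d + 2 * (suc m * suc n) ≡ (d + 2 * (m * n)) + 2 * (m + n + 1)
  d+2[1+m][1+n]≡d+2mn+2[m+n+1] = ℕ-Solver.solve-∀
  m²+n²+2[m+n+1]≡[1+m]²+[1+n]² : ∀ m n → (m * m + n * n) + 2 * (m + n + 1) ≡ suc m * suc m + suc n * suc n
  m²+n²+2[m+n+1]≡[1+m]²+[1+n]² = ℕ-Solver.solve-∀

-- ∑ₛ (k Fₛ - t)² = k² ∑ₛ Fₛ² - k t² when ∑ₛ Fₛ = t over k points s.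
∑-deviation²-≤ : ∀ {A : Set} (L : List A) (F : A → ℕ) {k t S e} →
  ∑[ _ ← L ] 1 ≡ k → ∑ L F ≡ t → ∑[ s ← L ] (F s * F s) ≡ S → k * S ≤ t * t + e →
  ∑[ s ← L ] (∣ k * F s - t ∣ * ∣ k * F s - t ∣) ≤ k * e
∑-deviation²-≤ {A} L F {k} {t} {S} {e} ∑1≡k ∑F≡t ∑F²≡S kS≤ = +-cancelˡ-≤ (2 * k * t * t) _ _ (begin
  2 * k * t * t + ∑ L D                     ≡⟨ +-comm (2 * k * t * t) (∑ L D) ⟩
  ∑ L D + 2 * k * t * t                     ≡⟨ ∑D+2ktt ⟩
  k * k * S + t * t * k                     ≤⟨ +-monoˡ-≤ (t * t * k) (≤-trans (≤-reflexive (*-assoc k k S)) (*-monoʳ-≤ k kS≤)) ⟩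
  k * (t * t + e) + t * t * k               ≡⟨ k[tt+e]+ttk≡2ktt+ke k t e ⟩
  2 * k * t * t + k * e                     ∎)
  where
  open ≤-Reasoning
  D : A → ℕ
  D s = ∣ k * F s - t ∣ * ∣ k * F s - t ∣
  k[tt+e]+ttk≡2ktt+ke : ∀ k t e → k * (t * t + e) + t * t * k ≡ 2 * k * t * t + k * e
  k[tt+e]+ttk≡2ktt+ke = ℕ-Solver.solve-∀
  2[kft]≡2ktf : ∀ k f t → 2 * (k * f * t) ≡ 2 * k * t * f
  2[kft]≡2ktf = ℕ-Solver.solve-∀
  kf[kf]≡kk[ff] : ∀ k f → k * f * (k * f) ≡ k * k * (f * f)
  kf[kf]≡kk[ff] = ℕ-Solver.solve-∀
  ∑D+2ktt : ∑ L D + 2 * k * t * t ≡ k * k * S + t * t * k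
  ∑D+2ktt = begin-equality
    ∑ L D + 2 * k * t * t
      ≡⟨ cong (∑ L D +_) (sym (trans (∑-cong L λ s → 2[kft]≡2ktf k (F s) t) (trans (∑-*ˡ L (2 * k * t) F) (cong (2 * k * t *_) ∑F≡t)))) ⟩
    ∑ L D + ∑[ s ← L ] (2 * (k * F s * t))
      ≡⟨ sym (∑-+ L D _) ⟩
    ∑[ s ← L ] (D s + 2 * (k * F s * t))
      ≡⟨ ∑-cong L (λ s → ∣m-n∣²+2mn≡m²+n² (k * F s) t) ⟩
    ∑[ s ← L ] (k * F s * (k * F s) + t * t)
      ≡⟨ ∑-+ L _ _ ⟩
    ∑[ s ← L ] (k * F s * (k * F s)) + ∑[ _ ← L ] (t * t)
      ≡⟨ cong₂ _+_ (trans (∑-cong L λ s → kf[kf]≡kk[ff] k (F s)) (trans (∑-*ˡ L (k * k) _) (cong (k * k *_) ∑F²≡S)))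
                   (trans (∑-cong L λ _ → sym (*-identityʳ (t * t))) (trans (∑-*ˡ L (t * t) _) (cong (t * t *_) ∑1≡k))) ⟩
    k * k * S + t * t * k ∎

-- Sums over F5^n

-- In each case the sum computes to (h t + 0) + 0.
∑-F5-δ : ∀ t (h : F5 → ℕ) → ∑[ c ← allFin 5 ] (𝟙 (t Fin.≟ c) * h c) ≡ h t
∑-F5-δ Fin.zero                                    h = trans (+-identityʳ _) (+-identityʳ _)
∑-F5-δ (Fin.suc Fin.zero)                          h = trans (+-identityʳ _) (+-identityʳ _)
∑-F5-δ (Fin.suc (Fin.suc Fin.zero))                h = trans (+-identityʳ _) (+-identityʳ _)
∑-F5-δ (Fin.suc (Fin.suc (Fin.suc Fin.zero)))      h = trans (+-identityʳ _) (+-identityʳ _)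
∑-F5-δ (Fin.suc (Fin.suc (Fin.suc (Fin.suc Fin.zero)))) h = trans (+-identityʳ _) (+-identityʳ _)

∑-allVecs-suc : ∀ n (f : F5^ (suc n) → ℕ) → ∑ (allVecs (suc n)) f ≡ ∑[ c ← allFin 5 ] ∑[ v ← allVecs n ] f (c ∷ v)
∑-allVecs-suc n f = trans (∑-concatMap (allFin 5) (λ c → List.map (c ∷_) (allVecs n)) f) (∑-cong (allFin 5) λ c → ∑-map (allVecs n) (c ∷_) f)

∑-allVecs-const : ∀ n k → ∑[ _ ← allVecs n ] k ≡ k * 5 ^ n
∑-allVecs-const zero    k = trans (+-identityʳ k) (sym (*-identityʳ k))
∑-allVecs-const (suc n) k = begin
  ∑[ _ ← allVecs (suc n) ] k                  ≡⟨ ∑-allVecs-suc n (λ _ → k) ⟩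
  ∑[ _ ← allFin 5 ] ∑[ _ ← allVecs n ] k       ≡⟨ ∑-cong (allFin 5) (λ _ → ∑-allVecs-const n k) ⟩
  ∑[ _ ← allFin 5 ] (k * 5 ^ n)               ≡⟨ ∑-const (allFin 5) (k * 5 ^ n) ⟩
  k * 5 ^ n * 5                               ≡⟨ kP5≡k[5P] k (5 ^ n) ⟩
  k * 5 ^ suc n                               ∎
  where
  open ≡-Reasoning
  kP5≡k[5P] : ∀ k P → k * P * 5 ≡ k * (5 * P)
  kP5≡k[5P] = ℕ-Solver.solve-∀

𝟙-≟V-∷ : ∀ {n} (t c : F5) (ts v : F5^ n) → 𝟙 ((t ∷ ts) ≟V (c ∷ v)) ≡ 𝟙 (t Fin.≟ c) * 𝟙 (ts ≟V v)
𝟙-≟V-∷ t c ts v = trans (𝟙-cong ((t ∷ ts) ≟V (c ∷ v)) ((t Fin.≟ c) ×-dec (ts ≟V v)) ∷-injective λ (t≡c , ts≡v) → cong₂ _∷_ t≡c ts≡v)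
                        (𝟙-× (t Fin.≟ c) (ts ≟V v))

∑-allVecs-δ : ∀ n (t : F5^ n) (g : F5^ n → ℕ) → ∑[ s ← allVecs n ] (𝟙 (t ≟V s) * g s) ≡ g t
∑-allVecs-δ zero    []       g = trans (+-identityʳ _) (+-identityʳ _)
∑-allVecs-δ (suc n) (t ∷ ts) g = begin
  ∑[ s ← allVecs (suc n) ] (𝟙 ((t ∷ ts) ≟V s) * g s)
    ≡⟨ ∑-allVecs-suc n _ ⟩
  ∑[ c ← allFin 5 ] ∑[ v ← allVecs n ] (𝟙 ((t ∷ ts) ≟V (c ∷ v)) * g (c ∷ v))
    ≡⟨ ∑-cong (allFin 5) (λ c → ∑-cong (allVecs n) λ v →
         trans (cong (_* g (c ∷ v)) (𝟙-≟V-∷ t c ts v)) (*-assoc (𝟙 (t Fin.≟ c)) _ _)) ⟩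
  ∑[ c ← allFin 5 ] ∑[ v ← allVecs n ] (𝟙 (t Fin.≟ c) * (𝟙 (ts ≟V v) * g (c ∷ v)))
    ≡⟨ ∑-cong (allFin 5) (λ c → trans (∑-*ˡ (allVecs n) (𝟙 (t Fin.≟ c)) _)
                                        (cong (𝟙 (t Fin.≟ c) *_) (∑-allVecs-δ n ts (λ v → g (c ∷ v))))) ⟩
  ∑[ c ← allFin 5 ] (𝟙 (t Fin.≟ c) * g (c ∷ ts))
    ≡⟨ ∑-F5-δ t (λ c → g (c ∷ ts)) ⟩
  g (t ∷ ts) ∎
  where open ≡-Reasoning

-- Translation is a bijection of F5^n, so it does not change sums over F5^n.
∑-allVecs-translate : ∀ n (x : F5^ n) (g : F5^ n → ℕ) → ∑[ z ← allVecs n ] g (x ⊕ z) ≡ ∑ (allVecs n) g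
∑-allVecs-translate n x g = begin
  ∑[ z ← allVecs n ] g (x ⊕ z)
    ≡⟨ ∑-cong (allVecs n) (λ z → sym (∑-allVecs-δ n (x ⊕ z) g)) ⟩
  ∑[ z ← allVecs n ] ∑[ s ← allVecs n ] (𝟙 ((x ⊕ z) ≟V s) * g s)
    ≡⟨ ∑-swap (allVecs n) (allVecs n) _ ⟩
  ∑[ s ← allVecs n ] ∑[ z ← allVecs n ] (𝟙 ((x ⊕ z) ≟V s) * g s)
    ≡⟨ ∑-cong (allVecs n) (λ s → ∑-cong (allVecs n) λ z →
         cong (_* g s) (𝟙-cong ((x ⊕ z) ≟V s) ((s ⊖ x) ≟V z) ⊕≡⇒⊖≡ ⊖≡⇒⊕≡)) ⟩
  ∑[ s ← allVecs n ] ∑[ z ← allVecs n ] (𝟙 ((s ⊖ x) ≟V z) * g s)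
    ≡⟨ ∑-cong (allVecs n) (λ s → ∑-allVecs-δ n (s ⊖ x) (λ _ → g s)) ⟩
  ∑ (allVecs n) g ∎
  where open ≡-Reasoning

≤-∑-allVecs : ∀ n (g : F5^ n → ℕ) t → g t ≤ ∑ (allVecs n) g
≤-∑-allVecs n g t = begin
  g t                                           ≡⟨ sym (∑-allVecs-δ n t g) ⟩
  ∑[ s ← allVecs n ] (𝟙 (t ≟V s) * g s)         ≤⟨ ∑-mono-≤ (allVecs n) (λ s → ≤-trans (*-monoˡ-≤ (g s) (𝟙≤1 (t ≟V s))) (≤-reflexive (+-identityʳ (g s)))) ⟩
  ∑ (allVecs n) g                               ∎
  where open ≤-Reasoning

module _ {A : Set} {k : ℕ} (L : List A) (f : A → F5^ k) where

  fibre : F5^ k → ℕ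
  fibre s = ∑[ x ← L ] 𝟙 (f x ≟V s)

  ∑-fibre : ∑ (allVecs k) fibre ≡ ∑[ _ ← L ] 1
  ∑-fibre = begin
    ∑[ s ← allVecs k ] ∑[ x ← L ] 𝟙 (f x ≟V s)       ≡⟨ ∑-swap (allVecs k) L (λ s x → 𝟙 (f x ≟V s)) ⟩
    ∑[ x ← L ] ∑[ s ← allVecs k ] 𝟙 (f x ≟V s)       ≡⟨ ∑-cong L (λ x → trans (∑-cong (allVecs k) λ s → sym (*-identityʳ _))
                                                                            (∑-allVecs-δ k (f x) (λ _ → 1))) ⟩
    ∑[ _ ← L ] 1                                     ∎
    where open ≡-Reasoning

  ∑-fibre² : ∑[ s ← allVecs k ] (fibre s * fibre s) ≡ ∑[ x ← L ] fibre (f x)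
  ∑-fibre² = begin
    ∑[ s ← allVecs k ] (fibre s * fibre s)                  ≡⟨ ∑-cong (allVecs k) (λ s → sym (∑-*ʳ L (λ x → 𝟙 (f x ≟V s)) (fibre s))) ⟩
    ∑[ s ← allVecs k ] ∑[ x ← L ] (𝟙 (f x ≟V s) * fibre s)  ≡⟨ ∑-swap (allVecs k) L (λ s x → 𝟙 (f x ≟V s) * fibre s) ⟩
    ∑[ x ← L ] ∑[ s ← allVecs k ] (𝟙 (f x ≟V s) * fibre s)  ≡⟨ ∑-cong L (λ x → ∑-allVecs-δ k (f x) fibre) ⟩
    ∑[ x ← L ] fibre (f x)                                  ∎
    where open ≡-Reasoning

fibre-deviation : ∀ {A : Set} {k} (L : List A) (f : A → F5^ k) {K t S e} →
  ∑[ _ ← allVecs k ] 1 ≡ K → ∑[ _ ← L ] 1 ≡ t → ∑[ x ← L ] fibre L f (f x) ≡ S → K * S ≤ t * t + e →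
  ∀ s → ∣ K * fibre L f s - t ∣ * ∣ K * fibre L f s - t ∣ ≤ K * e
fibre-deviation {k = k} L f {K} {t} {S} {e} ∑1≡K ∑L1≡t collisions≡S K*S≤ s = begin
  ∣ K * fibre L f s - t ∣ * ∣ K * fibre L f s - t ∣
    ≤⟨ ≤-∑-allVecs k (λ s → ∣ K * fibre L f s - t ∣ * ∣ K * fibre L f s - t ∣) s ⟩
  ∑[ s ← allVecs k ] (∣ K * fibre L f s - t ∣ * ∣ K * fibre L f s - t ∣)
    ≤⟨ ∑-deviation²-≤ (allVecs k) (fibre L f) ∑1≡K (trans (∑-fibre L f) ∑L1≡t) (trans (∑-fibre² L f) collisions≡S) K*S≤ ⟩
  K * e ∎
  where open ≤-Reasoning

-- Fibres of linear functionals

∑-𝟙-affine : ∀ k y d → k ≢ # 0 → ∑[ c ← allFin 5 ] 𝟙 (k *₅ c +₅ y Fin.≟ d) ≡ 1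
∑-𝟙-affine = exhaustive₃ λ k _ _ → ¬? (k Fin.≟ # 0) →-dec (_ ℕ.≟ _)

𝟙-+₅-move : ∀ a x c → 𝟙 (a +₅ x Fin.≟ c) ≡ 𝟙 (x Fin.≟ c -₅ a)
𝟙-+₅-move a x c = 𝟙-cong (a +₅ x Fin.≟ c) (x Fin.≟ c -₅ a) (to a x c) (from a x c)
  where
  to : ∀ a x c → a +₅ x ≡ c → x ≡ c -₅ a
  to = exhaustive₃ λ _ _ _ → (_ Fin.≟ _) →-dec (_ Fin.≟ _)
  from : ∀ a x c → x ≡ c -₅ a → a +₅ x ≡ c
  from = exhaustive₃ λ _ _ _ → (_ Fin.≟ _) →-dec (_ Fin.≟ _)

fibre-dot : ∀ n (u : F5^ n) → u ≢ zeroV → ∀ c → 5 * ∑[ v ← allVecs n ] 𝟙 (dot u v Fin.≟ c) ≡ 5 ^ n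
fibre-dot zero    []       u≢0 c = ⊥-elim (u≢0 refl)
fibre-dot (suc n) (u ∷ us) u≢0 c with us ≟V zeroV
... | yes refl = cong (5 *_) (begin
  ∑[ v ← allVecs (suc n) ] 𝟙 (dot (u ∷ zeroV) v Fin.≟ c)
    ≡⟨ ∑-allVecs-suc n _ ⟩
  ∑[ t ← allFin 5 ] ∑[ v ← allVecs n ] 𝟙 (u *₅ t +₅ dot zeroV v Fin.≟ c)
    ≡⟨ ∑-cong (allFin 5) (λ t → trans (∑-cong (allVecs n) λ v → cong (λ X → 𝟙 (u *₅ t +₅ X Fin.≟ c)) (dot-zeroˡ v))
                                       (∑-allVecs-const n _)) ⟩
  ∑[ t ← allFin 5 ] (𝟙 (u *₅ t +₅ # 0 Fin.≟ c) * 5 ^ n)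
    ≡⟨ ∑-*ʳ (allFin 5) (λ t → 𝟙 (u *₅ t +₅ # 0 Fin.≟ c)) (5 ^ n) ⟩
  (∑[ t ← allFin 5 ] 𝟙 (u *₅ t +₅ # 0 Fin.≟ c)) * 5 ^ n
    ≡⟨ cong (_* 5 ^ n) (∑-𝟙-affine u (# 0) c λ u≡0 → u≢0 (cong (_∷ zeroV) u≡0)) ⟩
  1 * 5 ^ n
    ≡⟨ *-identityˡ (5 ^ n) ⟩
  5 ^ n ∎)
  where open ≡-Reasoning
... | no us≢0 = begin
  5 * ∑[ v ← allVecs (suc n) ] 𝟙 (dot (u ∷ us) v Fin.≟ c)
    ≡⟨ cong (5 *_) (∑-allVecs-suc n _) ⟩
  5 * ∑[ t ← allFin 5 ] ∑[ v ← allVecs n ] 𝟙 (u *₅ t +₅ dot us v Fin.≟ c)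
    ≡⟨ sym (∑-*ˡ (allFin 5) 5 λ t → ∑[ v ← allVecs n ] 𝟙 (u *₅ t +₅ dot us v Fin.≟ c)) ⟩
  ∑[ t ← allFin 5 ] (5 * ∑[ v ← allVecs n ] 𝟙 (u *₅ t +₅ dot us v Fin.≟ c))
    ≡⟨ ∑-cong (allFin 5) (λ t → trans (cong (5 *_) (∑-cong (allVecs n) λ v → 𝟙-+₅-move (u *₅ t) (dot us v) c))
                                       (fibre-dot n us us≢0 (c -₅ u *₅ t))) ⟩
  ∑[ t ← allFin 5 ] (5 ^ n)
    ≡⟨ ∑-const (allFin 5) (5 ^ n) ⟩
  5 ^ n * 5
    ≡⟨ *-comm (5 ^ n) 5 ⟩
  5 ^ suc n ∎
  where open ≡-Reasoning

-- (b - t a)·z = d - t c reads β - d = t (α - c) for α = a·z, β = b·z: if α ≠ c exactly one t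
-- satisfies it, otherwise all five t or none.
pencil-count : ∀ α β c d →
  ∑[ t ← allFin 5 ] 𝟙 (β -₅ t *₅ α Fin.≟ d -₅ t *₅ c) + 𝟙 (α Fin.≟ c) ≡ 5 * (𝟙 (α Fin.≟ c) * 𝟙 (β Fin.≟ d)) + 1
pencil-count = exhaustive₄ λ _ _ _ _ → _ ℕ.≟ _

-- Summing fibre-dot over the pencil b - t a (no member of which vanishes) isolates the joint fibre.
fibre-dot₂ : ∀ n (a b : F5^ n) → a ≢ zeroV → (∀ t → b ≢ t ·ₛ a) → ∀ c d →
  25 * ∑[ z ← allVecs n ] (𝟙 (dot a z Fin.≟ c) * 𝟙 (dot b z Fin.≟ d)) ≡ 5 ^ n
fibre-dot₂ n a b a≢0 b≢ta c d = +-cancelʳ-≡ (5 * 5 ^ n) (25 * N) (5 ^ n) (begin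
  25 * N + 5 * 5 ^ n    ≡⟨ 25N+5P≡5[5N+P] N (5 ^ n) ⟩
  5 * (5 * N + 5 ^ n)   ≡⟨ cong (5 *_) (sym T+Y) ⟩
  5 * (T + Y)           ≡⟨ *-distribˡ-+ 5 T Y ⟩
  5 * T + 5 * Y         ≡⟨ cong₂ _+_ 5T 5Y ⟩
  5 * 5 ^ n + 5 ^ n     ≡⟨ +-comm (5 * 5 ^ n) (5 ^ n) ⟩
  5 ^ n + 5 * 5 ^ n     ∎)
  where
  open ≡-Reasoning
  𝕍 : List (F5^ n)
  𝕍 = allVecs n
  N Y T : ℕ
  N = ∑[ z ← 𝕍 ] (𝟙 (dot a z Fin.≟ c) * 𝟙 (dot b z Fin.≟ d))
  Y = ∑[ z ← 𝕍 ] 𝟙 (dot a z Fin.≟ c)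
  T = ∑[ z ← 𝕍 ] ∑[ t ← allFin 5 ] 𝟙 (dot (b ⊖ (t ·ₛ a)) z Fin.≟ d -₅ t *₅ c)

  25N+5P≡5[5N+P] : ∀ N P → 25 * N + 5 * P ≡ 5 * (5 * N + P)
  25N+5P≡5[5N+P] = ℕ-Solver.solve-∀

  T+Y : T + Y ≡ 5 * N + 5 ^ n
  T+Y = begin
    T + Y
      ≡⟨ sym (∑-+ 𝕍 _ _) ⟩
    ∑[ z ← 𝕍 ] (∑[ t ← allFin 5 ] 𝟙 (dot (b ⊖ (t ·ₛ a)) z Fin.≟ d -₅ t *₅ c) + 𝟙 (dot a z Fin.≟ c))
      ≡⟨ ∑-cong 𝕍 (λ z → trans (cong (_+ 𝟙 (dot a z Fin.≟ c)) (∑-cong (allFin 5) λ t →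
                                  cong (λ X → 𝟙 (X Fin.≟ d -₅ t *₅ c)) (dot-⊖-·ₛ t a b z)))
                               (pencil-count (dot a z) (dot b z) c d)) ⟩
    ∑[ z ← 𝕍 ] (5 * (𝟙 (dot a z Fin.≟ c) * 𝟙 (dot b z Fin.≟ d)) + 1)
      ≡⟨ ∑-+ 𝕍 _ _ ⟩
    ∑[ z ← 𝕍 ] (5 * (𝟙 (dot a z Fin.≟ c) * 𝟙 (dot b z Fin.≟ d))) + ∑[ z ← 𝕍 ] 1
      ≡⟨ cong₂ _+_ (∑-*ˡ 𝕍 5 _) (trans (∑-allVecs-const n 1) (*-identityˡ (5 ^ n))) ⟩
    5 * N + 5 ^ n ∎

  5T : 5 * T ≡ 5 * 5 ^ n
  5T = begin
    5 * T
      ≡⟨ cong (5 *_) (∑-swap 𝕍 (allFin 5) λ z t → 𝟙 (dot (b ⊖ (t ·ₛ a)) z Fin.≟ d -₅ t *₅ c)) ⟩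
    5 * ∑[ t ← allFin 5 ] ∑[ z ← 𝕍 ] 𝟙 (dot (b ⊖ (t ·ₛ a)) z Fin.≟ d -₅ t *₅ c)
      ≡⟨ sym (∑-*ˡ (allFin 5) 5 λ t → ∑[ z ← 𝕍 ] 𝟙 (dot (b ⊖ (t ·ₛ a)) z Fin.≟ d -₅ t *₅ c)) ⟩
    ∑[ t ← allFin 5 ] (5 * ∑[ z ← 𝕍 ] 𝟙 (dot (b ⊖ (t ·ₛ a)) z Fin.≟ d -₅ t *₅ c))
      ≡⟨ ∑-cong (allFin 5) (λ t → fibre-dot n (b ⊖ (t ·ₛ a)) (λ eq → b≢ta t (⊖≡zero⇒≡ eq)) (d -₅ t *₅ c)) ⟩
    ∑[ t ← allFin 5 ] (5 ^ n)
      ≡⟨ trans (∑-const (allFin 5) (5 ^ n)) (*-comm (5 ^ n) 5) ⟩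
    5 * 5 ^ n ∎

  5Y : 5 * Y ≡ 5 ^ n
  5Y = fibre-dot n a a≢0 c

-- From ℕ to the integer form of the bound

⊖-square : ∀ m n → (m ℤ.⊖ n) ℤ.* (m ℤ.⊖ n) ≡ ℤ.+ (∣ m - n ∣ * ∣ m - n ∣)
⊖-square zero    zero    = refl
⊖-square zero    (suc n) = +◃n≡+n _
⊖-square (suc m) zero    = +◃n≡+n _
⊖-square (suc m) (suc n) = trans (cong (λ i → i ℤ.* i) ([1+m]⊖[1+n]≡m⊖n m n)) (⊖-square m n)

ErrorBound-from-ℕ : ∀ C n N →
  ∣ 5 ^ 5 * N - 5 ^ (2 * n) ∣ * ∣ 5 ^ 5 * N - 5 ^ (2 * n) ∣ * 5 ^ n ≤ C * C * 5 ^ (4 * n + 10) → ErrorBound C n N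
ErrorBound-from-ℕ C n N bound = subst (ℤ._≤ ℤ.+ (C * C * 5 ^ (4 * n + 10))) (sym d²M≡) (ℤ.+≤+ bound)
  where
  A B M : ℕ
  A = 5 ^ 5 * N
  B = 5 ^ (2 * n)
  M = 5 ^ n
  d²M≡ : (ℤ.+ A ℤ.- ℤ.+ B) ℤ.* (ℤ.+ A ℤ.- ℤ.+ B) ℤ.* ℤ.+ M ≡ ℤ.+ (∣ A - B ∣ * ∣ A - B ∣ * M)
  d²M≡ = trans (cong (λ i → i ℤ.* i ℤ.* ℤ.+ M) (m-n≡m⊖n A B))
               (trans (cong (ℤ._* ℤ.+ M) (⊖-square A B)) (sym (pos-* (∣ A - B ∣ * ∣ A - B ∣) M)))

5^[2n]≡ : ∀ n → 5 ^ (2 * n) ≡ 5 ^ n * 5 ^ n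
5^[2n]≡ n = trans (^-distribˡ-+-* 5 n (n + 0)) (cong (λ m → 5 ^ n * 5 ^ m) (+-identityʳ n))

5^[4n+10]≡ : ∀ n → 5 ^ (4 * n + 10) ≡ (5 ^ n * 5 ^ n) * (5 ^ n * 5 ^ n) * 5 ^ 10
5^[4n+10]≡ n = begin
  5 ^ (4 * n + 10)                               ≡⟨ ^-distribˡ-+-* 5 (4 * n) 10 ⟩
  5 ^ (4 * n) * 5 ^ 10                          ≡⟨ cong (_* 5 ^ 10) (trans (cong (5 ^_) (*-comm 4 n)) (sym (^-*-assoc 5 n 4))) ⟩
  (5 ^ n) ^ 4 * 5 ^ 10                          ≡⟨ cong (_* 5 ^ 10) (P[P[P[P1]]]≡[PP][PP] (5 ^ n)) ⟩
  (5 ^ n * 5 ^ n) * (5 ^ n * 5 ^ n) * 5 ^ 10    ∎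
  where
  open ≡-Reasoning
  P[P[P[P1]]]≡[PP][PP] : ∀ P → P * (P * (P * (P * 1))) ≡ (P * P) * (P * P)
  P[P[P[P1]]]≡[PP][PP] = ℕ-Solver.solve-∀

-- Collisions of σ

ShiftConstraints : ∀ {n} (a b x y z w : F5^ n) → Set
ShiftConstraints a b x y z w =
  dot a z ≡ # 0 × dot b z ≡ # 0 × dot z x ≡ # 2 *₅ dot z z × dot a w ≡ # 0 × dot z y ≡ neg₅ (dot x w +₅ dot z w)

collision⇒constraints : ∀ {n} (a b x y z w : F5^ n) → σ a b (x ⊕ z) (y ⊕ w) ≡ σ a b x y → ShiftConstraints a b x y z w
collision⇒constraints a b x y z w collision =
    trans (dot-comm a z) (x+₅y≡x⇒y≡0 (dot x a) (dot z a) (trans (sym (dot-⊕ˡ x z a)) r≡r'))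
  , trans (dot-comm b z) (x+₅y≡x⇒y≡0 (dot x b) (dot z b) (trans (sym (dot-⊕ˡ x z b)) p≡p'))
  , [Q+X]+[X+Z]≡Q⇒X≡2Z (dot x x) (dot z x) (dot z z)
      (trans (cong (λ t → (dot x x +₅ t) +₅ (dot z x +₅ dot z z)) (dot-comm z x)) (trans (sym (dot-⊕-⊕ x z x z)) q≡q'))
  , x+₅y≡x⇒y≡0 (dot a y) (dot a w) (trans (sym (dot-⊕ʳ y w a)) e≡e')
  , [M+W]+[Y+V]≡M⇒Y≡-[W+V] (dot x y) (dot x w) (dot z y) (dot z w) (trans (sym (dot-⊕-⊕ x z y w)) m≡m')
  where
  open SameStatistics (σ-determines-statistics a b (x ⊕ z) (y ⊕ w) x y collision)
  [Q+X]+[X+Z]≡Q⇒X≡2Z : ∀ Q X Z → (Q +₅ X) +₅ (X +₅ Z) ≡ Q → X ≡ # 2 *₅ Z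
  [Q+X]+[X+Z]≡Q⇒X≡2Z = exhaustive₃ λ _ _ _ → (_ Fin.≟ _) →-dec (_ Fin.≟ _)
  [M+W]+[Y+V]≡M⇒Y≡-[W+V] : ∀ M W Y V → (M +₅ W) +₅ (Y +₅ V) ≡ M → Y ≡ neg₅ (W +₅ V)
  [M+W]+[Y+V]≡M⇒Y≡-[W+V] = exhaustive₄ λ _ _ _ _ → (_ Fin.≟ _) →-dec (_ Fin.≟ _)

pairs : ∀ n → List (F5^ n × F5^ n)
pairs n = concatMap (λ x → List.map (x ,_) (allVecs n)) (allVecs n)

∑-pairs : ∀ n (g : F5^ n × F5^ n → ℕ) → ∑ (pairs n) g ≡ ∑[ x ← allVecs n ] ∑[ y ← allVecs n ] g (x , y)
∑-pairs n g = trans (∑-concatMap (allVecs n) (λ x → List.map (x ,_) (allVecs n)) g)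
                    (∑-cong (allVecs n) λ x → ∑-map (allVecs n) (x ,_) g)

count≡fibre : ∀ {n} (a b : F5^ n) v → InCoset a b v → count a b v ≡ fibre (pairs n) (uncurry (σ a b)) (π v)
count≡fibre {n} a b v v∈coset =
  trans (length-filter≡∑-𝟙 (λ (x , y) → Φ a b x y ≟V v) (pairs n))
        (∑-cong (pairs n) λ (x , y) → 𝟙-cong (Φ a b x y ≟V v) (σ a b x y ≟V π v) (cong π) (Φ-determined-by-σ a b x y v v∈coset))

∑-pairs-1 : ∀ n → ∑[ _ ← pairs n ] 1 ≡ 5 ^ n * 5 ^ n
∑-pairs-1 n = trans (∑-pairs n (λ _ → 1)) (trans (∑-cong (allVecs n) λ _ → ∑-allVecs-const n 1)
                    (trans (∑-allVecs-const n (1 * 5 ^ n)) (cong (_* 5 ^ n) (*-identityˡ (5 ^ n)))))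

module SecondMoment {n : ℕ} (a b : F5^ n) (a≢0 : a ≢ zeroV) (b≢ta : ∀ t → b ≢ t ·ₛ a) where

  P : ℕ
  P = 5 ^ n

  P³ : ℕ
  P³ = P * (P * P)

  𝕍 : List (F5^ n)
  𝕍 = allVecs n

  collisions : ℕ
  collisions = ∑[ p ← pairs n ] fibre (pairs n) (uncurry (σ a b)) (uncurry (σ a b) p)

  z⊥a? : ∀ (z : F5^ n) → Dec (dot a z ≡ # 0)
  z⊥a? z = dot a z Fin.≟ # 0
  z⊥b? : ∀ (z : F5^ n) → Dec (dot b z ≡ # 0)
  z⊥b? z = dot b z Fin.≟ # 0
  x-constraint? : ∀ (z x : F5^ n) → Dec (dot z x ≡ # 2 *₅ dot z z)
  x-constraint? z x = dot z x Fin.≟ # 2 *₅ dot z z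
  w⊥a? : ∀ (w : F5^ n) → Dec (dot a w ≡ # 0)
  w⊥a? w = dot a w Fin.≟ # 0
  y-constraint? : ∀ (z x w y : F5^ n) → Dec (dot z y ≡ neg₅ (dot x w +₅ dot z w))
  y-constraint? z x w y = dot z y Fin.≟ neg₅ (dot x w +₅ dot z w)

  ⊥ab : F5^ n → ℕ
  ⊥ab z = 𝟙 (z⊥a? z) * 𝟙 (z⊥b? z)

  weight : (x y z w : F5^ n) → ℕ
  weight x y z w = ⊥ab z * (𝟙 (x-constraint? z x) * (𝟙 (w⊥a? w) * 𝟙 (y-constraint? z x w y)))

  shifts : F5^ n → ℕ
  shifts z = ⊥ab z * ∑[ x ← 𝕍 ] (𝟙 (x-constraint? z x) * ∑[ w ← 𝕍 ] (𝟙 (w⊥a? w) * ∑[ y ← 𝕍 ] 𝟙 (y-constraint? z x w y)))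

  collision≤weight : ∀ x y z w → 𝟙 (σ a b (x ⊕ z) (y ⊕ w) ≟V σ a b x y) ≤ weight x y z w
  collision≤weight x y z w =
    ≤-trans (𝟙-mono-≤ (σ a b (x ⊕ z) (y ⊕ w) ≟V σ a b x y) constraints? (collision⇒constraints a b x y z w))
            (≤-reflexive (trans (𝟙-×₅ (z⊥a? z) (z⊥b? z) (x-constraint? z x) (w⊥a? w) (y-constraint? z x w y))
                                (sym (*-assoc (𝟙 (z⊥a? z)) (𝟙 (z⊥b? z)) _))))
    where
    constraints? : Dec (ShiftConstraints a b x y z w)
    constraints? = z⊥a? z ×-dec z⊥b? z ×-dec x-constraint? z x ×-dec w⊥a? w ×-dec y-constraint? z x w y

  ∑-weight : ∀ z → ∑[ x ← 𝕍 ] ∑[ w ← 𝕍 ] ∑[ y ← 𝕍 ] weight x y z w ≡ shifts z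
  ∑-weight z = begin
    ∑[ x ← 𝕍 ] ∑[ w ← 𝕍 ] ∑[ y ← 𝕍 ] (⊥ab z * (X x * (W w * Y x w y)))
      ≡⟨ ∑-cong 𝕍 (λ x → ∑-cong 𝕍 λ w → trans (∑-*ˡ 𝕍 (⊥ab z) _) (cong (⊥ab z *_)
           (trans (∑-*ˡ 𝕍 (X x) _) (cong (X x *_) (∑-*ˡ 𝕍 (W w) (Y x w)))))) ⟩
    ∑[ x ← 𝕍 ] ∑[ w ← 𝕍 ] (⊥ab z * (X x * (W w * ∑ 𝕍 (Y x w))))
      ≡⟨ ∑-cong 𝕍 (λ x → trans (∑-*ˡ 𝕍 (⊥ab z) _) (cong (⊥ab z *_) (∑-*ˡ 𝕍 (X x) λ w → W w * ∑ 𝕍 (Y x w)))) ⟩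
    ∑[ x ← 𝕍 ] (⊥ab z * (X x * ∑[ w ← 𝕍 ] (W w * ∑ 𝕍 (Y x w))))
      ≡⟨ ∑-*ˡ 𝕍 (⊥ab z) _ ⟩
    shifts z ∎
    where
    open ≡-Reasoning
    X : F5^ n → ℕ
    X x = 𝟙 (x-constraint? z x)
    W : F5^ n → ℕ
    W w = 𝟙 (w⊥a? w)
    Y : F5^ n → F5^ n → F5^ n → ℕ
    Y x w y = 𝟙 (y-constraint? z x w y)

  collisions-as-shifts : collisions ≡ ∑[ x ← 𝕍 ] ∑[ y ← 𝕍 ] ∑[ z ← 𝕍 ] ∑[ w ← 𝕍 ] 𝟙 (σ a b (x ⊕ z) (y ⊕ w) ≟V σ a b x y)
  collisions-as-shifts = begin
    collisions
      ≡⟨ ∑-pairs n (λ p → fibre (pairs n) (uncurry (σ a b)) (uncurry (σ a b) p)) ⟩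
    ∑[ x ← 𝕍 ] ∑[ y ← 𝕍 ] fibre (pairs n) (uncurry (σ a b)) (σ a b x y)
      ≡⟨ ∑-cong 𝕍 (λ x → ∑-cong 𝕍 λ y → ∑-pairs n (λ (x' , y') → 𝟙 (σ a b x' y' ≟V σ a b x y))) ⟩
    ∑[ x ← 𝕍 ] ∑[ y ← 𝕍 ] ∑[ x' ← 𝕍 ] ∑[ y' ← 𝕍 ] 𝟙 (σ a b x' y' ≟V σ a b x y)
      ≡⟨ ∑-cong 𝕍 (λ x → ∑-cong 𝕍 λ y →
           trans (sym (∑-allVecs-translate n x λ x' → ∑[ y' ← 𝕍 ] 𝟙 (σ a b x' y' ≟V σ a b x y)))
                 (∑-cong 𝕍 λ z → sym (∑-allVecs-translate n y λ y' → 𝟙 (σ a b (x ⊕ z) y' ≟V σ a b x y)))) ⟩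
    ∑[ x ← 𝕍 ] ∑[ y ← 𝕍 ] ∑[ z ← 𝕍 ] ∑[ w ← 𝕍 ] 𝟙 (σ a b (x ⊕ z) (y ⊕ w) ≟V σ a b x y) ∎
    where open ≡-Reasoning

  collisions≤∑-shifts : collisions ≤ ∑ 𝕍 shifts
  collisions≤∑-shifts = begin
    collisions
      ≡⟨ collisions-as-shifts ⟩
    ∑[ x ← 𝕍 ] ∑[ y ← 𝕍 ] ∑[ z ← 𝕍 ] ∑[ w ← 𝕍 ] 𝟙 (σ a b (x ⊕ z) (y ⊕ w) ≟V σ a b x y)
      ≤⟨ ∑-mono-≤ 𝕍 (λ x → ∑-mono-≤ 𝕍 λ y → ∑-mono-≤ 𝕍 λ z → ∑-mono-≤ 𝕍 λ w → collision≤weight x y z w) ⟩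
    ∑[ x ← 𝕍 ] ∑[ y ← 𝕍 ] ∑[ z ← 𝕍 ] ∑[ w ← 𝕍 ] weight x y z w
      ≡⟨ ∑-reorder₄ 𝕍 𝕍 𝕍 𝕍 weight ⟩
    ∑[ z ← 𝕍 ] ∑[ x ← 𝕍 ] ∑[ w ← 𝕍 ] ∑[ y ← 𝕍 ] weight x y z w
      ≡⟨ ∑-cong 𝕍 ∑-weight ⟩
    ∑ 𝕍 shifts ∎
    where open ≤-Reasoning

  5∑w⊥a : 5 * ∑[ w ← 𝕍 ] 𝟙 (w⊥a? w) ≡ P
  5∑w⊥a = fibre-dot n a a≢0 (# 0)

  shifts-nonzero : ∀ z → z ≢ zeroV → 125 * shifts z ≡ ⊥ab z * P³
  shifts-nonzero z z≢0 = begin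
    125 * (⊥ab z * Sx)    ≡⟨ *-CS.x∙yz≈y∙xz 125 (⊥ab z) Sx ⟩
    ⊥ab z * (125 * Sx)    ≡⟨ cong (⊥ab z *_) 125Sx ⟩
    ⊥ab z * P³ ∎
    where
    open ≡-Reasoning
    Sy : F5^ n → F5^ n → ℕ
    Sy x w = ∑[ y ← 𝕍 ] 𝟙 (y-constraint? z x w y)
    Sw : F5^ n → ℕ
    Sw x = ∑[ w ← 𝕍 ] (𝟙 (w⊥a? w) * Sy x w)
    Sx : ℕ
    Sx = ∑[ x ← 𝕍 ] (𝟙 (x-constraint? z x) * Sw x)
    25Sw : ∀ x → 5 * 5 * Sw x ≡ P * P
    25Sw x = ∑-product-count 𝕍 (λ w → 𝟙 (w⊥a? w)) (Sy x) 5 5 5∑w⊥a λ w → fibre-dot n z z≢0 (neg₅ (dot x w +₅ dot z w))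
    125Sx : 125 * Sx ≡ P³
    125Sx = ∑-product-count 𝕍 (λ x → 𝟙 (x-constraint? z x)) Sw 5 25 (fibre-dot n z z≢0 (# 2 *₅ dot z z)) 25Sw

  shifts-zero : 5 * shifts zeroV ≤ P³
  shifts-zero = begin
    5 * shifts zeroV
      ≤⟨ *-monoʳ-≤ 5 (≤-trans (*-monoˡ-≤ _ (*-mono-≤ (𝟙≤1 (z⊥a? zeroV)) (𝟙≤1 (z⊥b? zeroV)))) (≤-reflexive (+-identityʳ _))) ⟩
    5 * ∑[ x ← 𝕍 ] (𝟙 (x-constraint? zeroV x) * ∑[ w ← 𝕍 ] (𝟙 (w⊥a? w) * ∑[ y ← 𝕍 ] 𝟙 (y-constraint? zeroV x w y)))
      ≤⟨ *-monoʳ-≤ 5 (∑-mono-≤ 𝕍 λ x → ≤-trans (*-monoˡ-≤ _ (𝟙≤1 (x-constraint? zeroV x))) (≤-reflexive (+-identityʳ _))) ⟩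
    5 * ∑[ x ← 𝕍 ] ∑[ w ← 𝕍 ] (𝟙 (w⊥a? w) * ∑[ y ← 𝕍 ] 𝟙 (y-constraint? zeroV x w y))
      ≤⟨ *-monoʳ-≤ 5 (∑-mono-≤ 𝕍 λ x → ∑-mono-≤ 𝕍 λ w → *-monoʳ-≤ (𝟙 (w⊥a? w))
           (≤-trans (∑-mono-≤ 𝕍 λ y → 𝟙≤1 (y-constraint? zeroV x w y)) (≤-reflexive (trans (∑-allVecs-const n 1) (*-identityˡ P))))) ⟩
    5 * ∑[ x ← 𝕍 ] ∑[ w ← 𝕍 ] (𝟙 (w⊥a? w) * P)
      ≡⟨ cong (5 *_) (trans (∑-cong 𝕍 λ x → ∑-*ʳ 𝕍 (λ w → 𝟙 (w⊥a? w)) P) (∑-allVecs-const n _)) ⟩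
    5 * (∑[ w ← 𝕍 ] 𝟙 (w⊥a? w) * P * P)
      ≡⟨ k[SPP]≡kS[PP] 5 (∑[ w ← 𝕍 ] 𝟙 (w⊥a? w)) P ⟩
    5 * ∑[ w ← 𝕍 ] 𝟙 (w⊥a? w) * (P * P)
      ≡⟨ cong (_* (P * P)) 5∑w⊥a ⟩
    P³ ∎
    where
    open ≤-Reasoning
    k[SPP]≡kS[PP] : ∀ k S P → k * (S * P * P) ≡ k * S * (P * P)
    k[SPP]≡kS[PP] = ℕ-Solver.solve-∀

  shifts-bound : ∀ z → 125 * shifts z ≤ ⊥ab z * P³ + 𝟙 (zeroV ≟V z) * (25 * P³)
  shifts-bound z with zeroV ≟V z
  ... | yes refl = begin
    125 * shifts zeroV                  ≡⟨ *-assoc 25 5 (shifts zeroV) ⟩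
    25 * (5 * shifts zeroV)             ≤⟨ *-monoʳ-≤ 25 shifts-zero ⟩
    25 * P³                             ≤⟨ m≤n+m (25 * P³) (⊥ab zeroV * P³) ⟩
    ⊥ab zeroV * P³ + 25 * P³            ≡⟨ cong (⊥ab zeroV * P³ +_) (sym (*-identityˡ (25 * P³))) ⟩
    ⊥ab zeroV * P³ + 1 * (25 * P³)      ∎
    where open ≤-Reasoning
  ... | no 0≢z   = ≤-reflexive (trans (shifts-nonzero z (λ z≡0 → 0≢z (sym z≡0))) (sym (+-identityʳ _)))

  collisions-bound : 3125 * collisions ≤ (P * P) * (P * P) + 625 * P³
  collisions-bound = begin
    3125 * collisions
      ≤⟨ *-monoʳ-≤ 3125 collisions≤∑-shifts ⟩
    3125 * ∑ 𝕍 shifts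
      ≡⟨ *-assoc 25 125 (∑ 𝕍 shifts) ⟩
    25 * (125 * ∑ 𝕍 shifts)
      ≡⟨ cong (25 *_) (sym (∑-*ˡ 𝕍 125 shifts)) ⟩
    25 * ∑[ z ← 𝕍 ] (125 * shifts z)
      ≤⟨ *-monoʳ-≤ 25 (∑-mono-≤ 𝕍 shifts-bound) ⟩
    25 * ∑[ z ← 𝕍 ] (⊥ab z * P³ + 𝟙 (zeroV ≟V z) * (25 * P³))
      ≡⟨ cong (25 *_) (trans (∑-+ 𝕍 _ _) (cong₂ _+_ (∑-*ʳ 𝕍 ⊥ab P³) (∑-allVecs-δ n zeroV (λ _ → 25 * P³)))) ⟩
    25 * (∑ 𝕍 ⊥ab * P³ + 25 * P³)
      ≡⟨ 25[SQ+25Q]≡25SQ+625Q (∑ 𝕍 ⊥ab) P³ ⟩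
    25 * ∑ 𝕍 ⊥ab * P³ + 625 * P³
      ≡⟨ cong (λ t → t * P³ + 625 * P³) (fibre-dot₂ n a b a≢0 b≢ta (# 0) (# 0)) ⟩
    P * P³ + 625 * P³
      ≡⟨ cong (_+ 625 * P³) (P[P[PP]]≡[PP][PP] P) ⟩
    (P * P) * (P * P) + 625 * P³ ∎
    where
    open ≤-Reasoning
    25[SQ+25Q]≡25SQ+625Q : ∀ S Q → 25 * (S * Q + 25 * Q) ≡ 25 * S * Q + 625 * Q
    25[SQ+25Q]≡25SQ+625Q = ℕ-Solver.solve-∀
    P[P[PP]]≡[PP][PP] : ∀ P → P * (P * (P * P)) ≡ (P * P) * (P * P)
    P[P[PP]]≡[PP][PP] = ℕ-Solver.solve-∀


  count-deviation : ∀ v → InCoset a b v → ∣ 3125 * count a b v - P * P ∣ * ∣ 3125 * count a b v - P * P ∣ ≤ 3125 * (625 * P³)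
  count-deviation v v∈coset =
    subst (λ N → ∣ 3125 * N - P * P ∣ * ∣ 3125 * N - P * P ∣ ≤ 3125 * (625 * P³))
          (sym (count≡fibre a b v v∈coset))
          (fibre-deviation (pairs n) (uncurry (σ a b)) {3125} (∑-allVecs-const 5 1) (∑-pairs-1 n) refl collisions-bound (π v))

  -- Large literal factors stay on the right: _*_ recurses on its left argument, so comparing
  -- 3125 * X with 3125 * Y, for X and Y equal only after unfolding, unfolds the literal.
  count-error-bound : ∀ v → InCoset a b v → ErrorBound 1 n (count a b v)
  count-error-bound v v∈coset = ErrorBound-from-ℕ 1 n N (begin
    ∣ 5 ^ 5 * N - 5 ^ (2 * n) ∣ * ∣ 5 ^ 5 * N - 5 ^ (2 * n) ∣ * P
      ≡⟨ cong (λ B → ∣ 3125 * N - B ∣ * ∣ 3125 * N - B ∣ * P) (5^[2n]≡ n) ⟩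
    ∣ 3125 * N - P * P ∣ * ∣ 3125 * N - P * P ∣ * P
      ≤⟨ *-monoˡ-≤ P (count-deviation v v∈coset) ⟩
    3125 * (625 * P³) * P
      ≡⟨ k[l[P[PP]]]P≡[PP][PP][kl] 3125 625 P ⟩
    (P * P) * (P * P) * (3125 * 625)
      ≤⟨ *-monoʳ-≤ ((P * P) * (P * P)) (m≤m*n (3125 * 625) 5) ⟩
    (P * P) * (P * P) * 5 ^ 10
      ≡⟨ sym (5^[4n+10]≡ n) ⟩
    5 ^ (4 * n + 10)
      ≡⟨ sym (*-identityˡ (5 ^ (4 * n + 10))) ⟩
    1 * 1 * 5 ^ (4 * n + 10) ∎)
    where
    open ≤-Reasoning
    N : ℕ
    N = count a b v
    k[l[P[PP]]]P≡[PP][PP][kl] : ∀ k l P → k * (l * (P * (P * P))) * P ≡ (P * P) * (P * P) * (k * l)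
    k[l[P[PP]]]P≡[PP][PP][kl] = ℕ-Solver.solve-∀

-- b ≢ 0 and a ∉ F5·b follow from a ≢ 0 and b ∉ F5·a.
proposition6p1 : ∃ λ (C : ℕ) → ∀ (n : ℕ) (a b : F5^ n) → a ≢ zeroV → b ≢ zeroV → NotMultiples a b → ∀ (v : F5^ 8) → InCoset a b v → ErrorBound C n (count a b v)
proposition6p1 = 1 , λ n a b a≢0 _ (b∉F5a , _) → SecondMoment.count-error-bound a b a≢0 (λ t b≡ta → b∉F5a (t , b≡ta))
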